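{- For all integers $i\neq j$, the operators $u_i$ and $d_j$ on $\mathbf F$ commute: $u_id_j=d_ju_i$.
   Context: Fix an integer $n\ge 1$. Partitions are drawn in English notation; the box in row $r$ and column $c$ lies on diagonal $c-r$. An $n$-ribbon is a connected skew shape with $n$ boxes containing no $2\times 2$ square; its head is its top-right box, and its spin is its number of rows minus $1$. Let $K=\mathbb{C}(q)$ and let $\mathbf F$ be the $K$-vector space with basis the set of all partitions. For $i\in\mathbb{Z}$, $u_i\in\mathrm{End}_K(\mathbf F)$ is defined by $u_i(\lambda)=q^{\mathrm{spin}(\mu/\lambda)}\mu$ if $\mu/\lambda$ is an $n$-ribbon with head on diagonal $i$ for some partition $\mu$, and $u_i(\lambda)=0$ otherwise; $d_i\in\mathrm{End}_K(\mathbf F)$ is defined by $d_i(\lambda)=q^{\mathrm{spin}(\lambda/\nu)}\nu$ if $\lambda/\nu$ is an $n$-ribbon with head on diagonal $i$ for some partition $\nu$, and $d_i(\lambda)=0$ otherwise ($d_i$ is the adjoint of $u_i$ for the inner product making the partitions orthonormal). -}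

module Defs where

open import Data.Nat using (ℕ; zero; suc; _+_; _≤_; _<_; _<ᵇ_)
open import Data.Integer as ℤ using (ℤ; +_)
open import Data.List using (List; []; _∷_; map; length; upTo)
open import Data.Nat.ListAction using (sum)
open import Data.List.Relation.Unary.All using (All)
open import Data.List.Relation.Unary.Linked using (Linked)
open import Data.Product using (Σ; _×_; _,_; ∃)
open import Data.Bool using (if_then_else_)
open import Relation.Nullary using (¬_)
open import Relation.Binary.PropositionalEquality using (_≡_)

record Partition : Set where
  constructor mkPartition
  field
    parts      : List ℕ
    decreasing : Linked (λ a b → b ≤ a) parts
    positive   : All (λ a → 0 < a) parts
open Partition public

rowLen : List ℕ → ℕ → ℕ
rowLen []       _       = 0
rowLen (x ∷ xs) zero    = x
rowLen (x ∷ xs) (suc r) = rowLen xs r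

-- boxes: (row r, column c), 0-indexed; (r , c) ∈ λ iff c < λ_r
Box : Set
Box = ℕ × ℕ

_∈ᴾ_ : Box → Partition → Set
(r , c) ∈ᴾ λ' = c < rowLen (parts λ') r

-- diagonal of a box: column minus row (same for 0- or 1-indexing)
diag : Box → ℤ
diag (r , c) = + c ℤ.- + r

_⊆ᴾ_ : Partition → Partition → Set
λ' ⊆ᴾ μ = ∀ r → rowLen (parts λ') r ≤ rowLen (parts μ) r

InSkew : Partition → Partition → Box → Set
InSkew μ λ' b = b ∈ᴾ μ × ¬ (b ∈ᴾ λ')

data Adj : Box → Box → Set where
  right : ∀ {r c} → Adj (r , c) (r , suc c)
  left  : ∀ {r c} → Adj (r , suc c) (r , c)
  down  : ∀ {r c} → Adj (r , c) (suc r , c)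
  up    : ∀ {r c} → Adj (suc r , c) (r , c)

data Path (μ λ' : Partition) : Box → Box → Set where
  here : ∀ {b} → Path μ λ' b b
  step : ∀ {b b' b''} → Adj b b' → InSkew μ λ' b' → Path μ λ' b' b'' → Path μ λ' b b''

Connected : Partition → Partition → Set
Connected μ λ' = ∀ b b' → InSkew μ λ' b → InSkew μ λ' b' → Path μ λ' b b'

No2x2 : Partition → Partition → Set
No2x2 μ λ' = ¬ (Σ ℕ λ r → Σ ℕ λ c →
  InSkew μ λ' (r , c) × InSkew μ λ' (suc r , c) ×
  InSkew μ λ' (r , suc c) × InSkew μ λ' (suc r , suc c))

size : Partition → ℕ
size λ' = sum (parts λ')

HeadOn : Partition → Partition → ℤ → Set
HeadOn μ λ' i = Σ Box λ h → InSkew μ λ' h × diag h ≡ i ×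
  (∀ b → InSkew μ λ' b → (Data.Product.proj₁ h ≤ Data.Product.proj₁ b) ×
     (Data.Product.proj₁ b ≡ Data.Product.proj₁ h → Data.Product.proj₂ b ≤ Data.Product.proj₂ h))

rowsOf : Partition → Partition → ℕ
rowsOf μ λ' = sum (map (λ r → if rowLen (parts λ') r <ᵇ rowLen (parts μ) r then 1 else 0)
                       (upTo (length (parts μ))))

-- μ/λ is an n-ribbon with head on diagonal i and spin s (= number of rows - 1)
Ribbon : ℕ → Partition → Partition → ℤ → ℕ → Set
Ribbon n μ λ' i s =
  λ' ⊆ᴾ μ × size μ ≡ size λ' + n × Connected μ λ' × No2x2 μ λ' ×
  HeadOn μ λ' i × rowsOf μ λ' ≡ suc s

-- Coefficient description of the operators on F (basis = partitions):
-- u_i λ = q^s μ  iff  Ribbon n μ λ i s ;   d_i λ = q^s ν  iff  Ribbon n λ ν i s.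
-- "u_i d_j λ = q^a μ" : there is ν with d_j λ = q^s ν, u_i ν = q^t μ, s + t = a.
UD : ℕ → ℤ → ℤ → Partition → ℕ → Partition → Set
UD n i j λ' a μ = Σ Partition λ ν → Σ ℕ λ s → Σ ℕ λ t →
  Ribbon n λ' ν j s × Ribbon n μ ν i t × s + t ≡ a

-- "d_j u_i λ = q^a μ"
DU : ℕ → ℤ → ℤ → Partition → ℕ → Partition → Set
DU n i j λ' a μ = Σ Partition λ ν → Σ ℕ λ s → Σ ℕ λ t →
  Ribbon n ν λ' i s × Ribbon n ν μ j t × s + t ≡ a

module Submission where

-- Read a partition through its beads: row r of length λ_r carries a bead at position λ_r − r.
-- Adding an n-ribbon whose head lies on diagonal i is the same as moving a bead from the
-- position i + 1 − n to the free position i + 1, and the spin of the ribbon is the number of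
-- beads strictly between these two positions.  For i ≠ j the moves behind u_i and d_j have
-- distinct sources and distinct targets, so they can be performed in either order with the same
-- resulting bead set, and a partition is determined by its beads; this matches the terms of
-- u_i d_j λ with those of d_j u_i λ.  The spins agree because a move from p′ to q′ changes the
-- number of beads in (p, q) by [q′ ∈ (p, q)] − [p′ ∈ (p, q)], and for two intervals
-- (p, p + n), (p′, p′ + n) of the same length with p ≠ p′,
--   [p′ ∈ (p, p + n)] + [p ∈ (p′, p′ + n)] = [p′ + n ∈ (p, p + n)] + [p + n ∈ (p′, p′ + n)].

open import Defs
open import Data.Nat using (ℕ; _≤_)
open import Data.Integer using (ℤ)
open import Relation.Nullary using (¬_)
open import Relation.Binary.PropositionalEquality using (_≡_)
open import Function.Bundles using (_⇔_)

open import Data.Nat.Base as ℕ using (zero; suc; pred; _+_; _*_; _∸_; _<_; z≤n; s≤s; _<ᵇ_)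
import Data.Nat.Properties as ℕ
open import Data.Nat.ListAction using (sum)
import Data.Nat.Tactic.RingSolver as ℕ-Ring
open import Data.Integer.Base as ℤ using (+_; -_; -[1+_]; ∣_∣; 0ℤ; 1ℤ)
import Data.Integer.Properties as ℤ
import Data.Integer.Tactic.RingSolver as ℤ-Ring
open import Algebra.Bundles using (AbelianGroup)
open import Algebra.Properties.CommutativeSemigroup ℕ.+-commutativeSemigroup
  using () renaming (interchange to +-interchange)
open import Algebra.Properties.Group (AbelianGroup.group ℤ.+-0-abelianGroup)
  using () renaming (//-rightDividesʳ to [i+j]-j≡i; //-rightDividesˡ to [i-j]+j≡i; ∙-cancelʳ to +-cancelʳ-≡ℤ)
open import Data.Bool.Base using (if_then_else_; true; false; T)
open import Data.Unit.Base using (tt)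
open import Data.List.Base using (List; []; _∷_; length; map; applyUpTo)
open import Data.List.Relation.Unary.All using (All; []; _∷_)
open import Data.List.Relation.Unary.Linked using (Linked; []; [-]; _∷_)
open import Data.Product.Base using (Σ; ∃; _×_; _,_; proj₁; proj₂)
open import Data.Sum.Base using (_⊎_; inj₁; inj₂)
open import Function.Base using (id)
open import Function.Bundles using (mk⇔)
open import Relation.Nullary using (Dec; yes; no; ¬?; contradiction)
open import Relation.Nullary.Decidable using (decidable-stable)
open import Relation.Unary using (Decidable)
open import Relation.Binary.Definitions using (tri<; tri≈; tri>)
open import Relation.Binary.PropositionalEquality
  using (_≢_; refl; sym; trans; cong; cong₂; subst; subst₂; ≢-sym; module ≡-Reasoning)
open ≡-Reasoning

sumBelow : ℕ → (ℕ → ℕ) → ℕ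
sumBelow zero    f = 0
sumBelow (suc N) f = sumBelow N f + f N

sumBelow-cong : ∀ N {f g} → (∀ r → r < N → f r ≡ g r) → sumBelow N f ≡ sumBelow N g
sumBelow-cong zero    f≗g = refl
sumBelow-cong (suc N) f≗g =
  cong₂ _+_ (sumBelow-cong N (λ r r<N → f≗g r (ℕ.m<n⇒m<1+n r<N))) (f≗g N ℕ.≤-refl)

sumBelow-const : ∀ N {f c} → (∀ r → r < N → f r ≡ c) → sumBelow N f ≡ N * c
sumBelow-const zero    f≗c = refl
sumBelow-const (suc N) {f} {c} f≗c = begin
  sumBelow N f + f N
    ≡⟨ cong₂ _+_ (sumBelow-const N (λ r r<N → f≗c r (ℕ.m<n⇒m<1+n r<N))) (f≗c N ℕ.≤-refl) ⟩
  N * c + c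
    ≡⟨ ℕ.+-comm (N * c) c ⟩
  suc N * c ∎

sumBelow-zero : ∀ N {f} → (∀ r → r < N → f r ≡ 0) → sumBelow N f ≡ 0
sumBelow-zero N f≗0 = trans (sumBelow-const N f≗0) (ℕ.*-zeroʳ N)

sumBelow-one : ∀ N {f} → (∀ r → r < N → f r ≡ 1) → sumBelow N f ≡ N
sumBelow-one N f≗1 = trans (sumBelow-const N f≗1) (ℕ.*-identityʳ N)

sumBelow-distrib : ∀ N f g → sumBelow N (λ r → f r + g r) ≡ sumBelow N f + sumBelow N g
sumBelow-distrib zero    f g = refl
sumBelow-distrib (suc N) f g = begin
  sumBelow N (λ r → f r + g r) + (f N + g N)
    ≡⟨ cong (_+ (f N + g N)) (sumBelow-distrib N f g) ⟩
  sumBelow N f + sumBelow N g + (f N + g N)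
    ≡⟨ +-interchange (sumBelow N f) (sumBelow N g) (f N) (g N) ⟩
  sumBelow N f + f N + (sumBelow N g + g N) ∎

sumBelow-+ : ∀ m n f → sumBelow (n + m) f ≡ sumBelow m f + sumBelow n (λ k → f (k + m))
sumBelow-+ m zero    f = sym (ℕ.+-identityʳ _)
sumBelow-+ m (suc n) f =
  trans (cong (_+ f (n + m)) (sumBelow-+ m n f)) (ℕ.+-assoc (sumBelow m f) _ _)

sumBelow-suc : ∀ N f → sumBelow (suc N) f ≡ f 0 + sumBelow N (λ r → f (suc r))
sumBelow-suc zero    f = ℕ.+-comm 0 (f 0)
sumBelow-suc (suc N) f =
  trans (cong (_+ f (suc N)) (sumBelow-suc N f)) (ℕ.+-assoc (f 0) (sumBelow N (λ r → f (suc r))) _)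

sumBelow-window : ∀ a w N → w + a ≤ N → ∀ f → sumBelow N f ≡
  sumBelow a f + (sumBelow w (λ k → f (k + a)) + sumBelow (N ∸ (w + a)) (λ k → f (k + (w + a))))
sumBelow-window a w N w+a≤N f = begin
  sumBelow N f
    ≡⟨ cong (λ N → sumBelow N f) (sym (ℕ.m∸n+n≡m w+a≤N)) ⟩
  sumBelow (N ∸ (w + a) + (w + a)) f
    ≡⟨ sumBelow-+ (w + a) (N ∸ (w + a)) f ⟩
  sumBelow (w + a) f + tail
    ≡⟨ cong (_+ tail) (sumBelow-+ a w f) ⟩
  sumBelow a f + sumBelow w (λ k → f (k + a)) + tail
    ≡⟨ ℕ.+-assoc (sumBelow a f) _ tail ⟩
  sumBelow a f + (sumBelow w (λ k → f (k + a)) + tail) ∎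
  where
  tail : ℕ
  tail = sumBelow (N ∸ (w + a)) (λ k → f (k + (w + a)))

sumBelow-block : ∀ {f} a w N → w + a ≤ N →
  (∀ r → r < a → f r ≡ 0) → (∀ k → k < w → f (k + a) ≡ 1) → (∀ r → w + a ≤ r → f r ≡ 0) →
  sumBelow N f ≡ w
sumBelow-block {f} a w N w+a≤N before inside after = begin
  sumBelow N f
    ≡⟨ sumBelow-window a w N w+a≤N f ⟩
  sumBelow a f + (sumBelow w (λ k → f (k + a)) + sumBelow m (λ k → f (k + (w + a))))
    ≡⟨ cong₂ _+_ (sumBelow-zero a before)
         (cong₂ _+_ (sumBelow-one w inside) (sumBelow-zero m (λ k _ → after _ (ℕ.m≤n+m _ k)))) ⟩
  0 + (w + 0)
    ≡⟨ ℕ.+-identityʳ w ⟩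
  w ∎
  where
  m : ℕ
  m = N ∸ (w + a)

sumBelow-stable : ∀ {f n} N → n ≤ N → (∀ r → n ≤ r → f r ≡ 0) → sumBelow N f ≡ sumBelow n f
sumBelow-stable {f} {n} N n≤N vanish = begin
  sumBelow N f
    ≡⟨ sumBelow-window n 0 N n≤N f ⟩
  sumBelow n f + (0 + sumBelow (N ∸ n) (λ k → f (k + n)))
    ≡⟨ cong (_+_ (sumBelow n f)) (sumBelow-zero (N ∸ n) (λ k _ → vanish _ (ℕ.m≤n+m n k))) ⟩
  sumBelow n f + 0
    ≡⟨ ℕ.+-identityʳ _ ⟩
  sumBelow n f ∎

-- With c = 0 this compares bead positions before and after a ribbon is added, with c = 1 row lengths.
sumBelow-shift : ∀ {g h} a s c N → suc (s + a) ≤ N →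
  (∀ r → r < a → g r ≡ h r) → (∀ k → k < s → g (suc (k + a)) ≡ c + h (k + a)) →
  (∀ r → suc (s + a) ≤ r → g r ≡ h r) →
  sumBelow N g + h (s + a) ≡ sumBelow N h + (g a + s * c)
sumBelow-shift {g} {h} a s c N bound before inside after = begin
  sumBelow N g + h (s + a)
    ≡⟨ cong (_+ h (s + a)) (sumBelow-window a (suc s) N bound g) ⟩
  sumBelow a g + (sumBelow (suc s) (λ k → g (k + a)) + tail g) + h (s + a)
    ≡⟨ cong₂ (λ x y → x + (sumBelow (suc s) (λ k → g (k + a)) + y) + h (s + a))
             (sumBelow-cong a before) (sumBelow-cong m (λ k _ → after _ (ℕ.m≤n+m _ k))) ⟩
  sumBelow a h + (sumBelow (suc s) (λ k → g (k + a)) + tail h) + h (s + a)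
    ≡⟨ cong (λ x → sumBelow a h + (x + tail h) + h (s + a)) window ⟩
  sumBelow a h + (g a + (s * c + sumBelow s (λ k → h (k + a))) + tail h) + h (s + a)
    ≡⟨ rearrange (sumBelow a h) (g a) (s * c) _ (tail h) (h (s + a)) ⟩
  sumBelow a h + (sumBelow (suc s) (λ k → h (k + a)) + tail h) + (g a + s * c)
    ≡⟨ cong (_+ (g a + s * c)) (sym (sumBelow-window a (suc s) N bound h)) ⟩
  sumBelow N h + (g a + s * c) ∎
  where
  m : ℕ
  m = N ∸ (suc s + a)
  tail : (ℕ → ℕ) → ℕ
  tail f = sumBelow m (λ k → f (k + (suc s + a)))
  window : sumBelow (suc s) (λ k → g (k + a)) ≡ g a + (s * c + sumBelow s (λ k → h (k + a)))
  window = begin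
    sumBelow (suc s) (λ k → g (k + a))
      ≡⟨ sumBelow-suc s _ ⟩
    g a + sumBelow s (λ k → g (suc k + a))
      ≡⟨ cong (_+_ (g a)) (sumBelow-cong s inside) ⟩
    g a + sumBelow s (λ k → c + h (k + a))
      ≡⟨ cong (_+_ (g a)) (sumBelow-distrib s (λ _ → c) _) ⟩
    g a + (sumBelow s (λ _ → c) + sumBelow s (λ k → h (k + a)))
      ≡⟨ cong (λ x → g a + (x + sumBelow s (λ k → h (k + a)))) (sumBelow-const s (λ _ _ → refl)) ⟩
    g a + (s * c + sumBelow s (λ k → h (k + a))) ∎
  rearrange : ∀ A X Y Z B W → A + ((X + (Y + Z)) + B) + W ≡ A + ((Z + W) + B) + (X + Y)
  rearrange = ℕ-Ring.solve-∀

-- Partitions as weakly decreasing row-length functions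

Decreasing : (ℕ → ℕ) → Set
Decreasing f = ∀ r → f (suc r) ≤ f r

decreasing-antitone : ∀ {f} → Decreasing f → ∀ {r r′} → r ≤ r′ → f r′ ≤ f r
decreasing-antitone {f} dec {r} r≤r′ with ℕ.m≤n⇒∃[o]m+o≡n r≤r′
... | k , refl = go k
  where
  go : ∀ k → f (r + k) ≤ f r
  go zero    = ℕ.≤-reflexive (cong f (ℕ.+-identityʳ r))
  go (suc k) = ℕ.≤-trans (ℕ.≤-reflexive (cong f (ℕ.+-suc r k))) (ℕ.≤-trans (dec (r + k)) (go k))

row : Partition → ℕ → ℕ
row π = rowLen (parts π)

ℓ : Partition → ℕ
ℓ π = length (parts π)

row-decreasing : ∀ π → Decreasing (row π)
row-decreasing π = go (parts π) (decreasing π)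
  where
  go : ∀ xs → Linked (λ a b → b ≤ a) xs → Decreasing (rowLen xs)
  go []           _          r       = z≤n
  go (x ∷ [])     _          r       = z≤n
  go (x ∷ y ∷ ys) (y≤x ∷ _)  zero    = y≤x
  go (x ∷ y ∷ ys) (_ ∷ ys↓)  (suc r) = go (y ∷ ys) ys↓ r

row-beyond : ∀ π {r} → ℓ π ≤ r → row π r ≡ 0
row-beyond π = go (parts π)
  where
  go : ∀ xs {r} → length xs ≤ r → rowLen xs r ≡ 0
  go []       _         = refl
  go (x ∷ xs) (s≤s ℓ≤r) = go xs ℓ≤r

row-positive : ∀ π {r} → r < ℓ π → 0 < row π r
row-positive π = go (parts π) (positive π)
  where
  go : ∀ xs → All (0 <_) xs → ∀ {r} → r < length xs → 0 < rowLen xs r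
  go (x ∷ xs) (0<x ∷ _)   {zero}  _         = 0<x
  go (x ∷ xs) (_ ∷ xs>0)  {suc r} (s≤s r<ℓ) = go xs xs>0 r<ℓ

row-positive⇒<ℓ : ∀ π {r} → 0 < row π r → r < ℓ π
row-positive⇒<ℓ π {r} 0<row = ℕ.≰⇒> (λ ℓ≤r → ℕ.<⇒≢ 0<row (sym (row-beyond π ℓ≤r)))

⊆⇒ℓ≤ : ∀ {λ′ μ} → λ′ ⊆ᴾ μ → ℓ λ′ ≤ ℓ μ
⊆⇒ℓ≤ {λ′} {μ} λ⊆μ = ℕ.≮⇒≥ λ ℓμ<ℓλ →
  ℕ.<⇒≱ (row-positive λ′ ℓμ<ℓλ) (ℕ.≤-trans (λ⊆μ (ℓ μ)) (ℕ.≤-reflexive (row-beyond μ ℕ.≤-refl)))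

size≡sumBelow : ∀ π {N} → ℓ π ≤ N → size π ≡ sumBelow N (row π)
size≡sumBelow π {N} ℓ≤N =
  trans (go (parts π)) (sym (sumBelow-stable N ℓ≤N (λ r → row-beyond π)))
  where
  go : ∀ xs → sum xs ≡ sumBelow (length xs) (rowLen xs)
  go []       = refl
  go (x ∷ xs) = trans (cong (_+_ x) (go xs)) (sym (sumBelow-suc (length xs) (rowLen (x ∷ xs))))

occupied : (ℕ → ℕ) → (ℕ → ℕ) → ℕ → ℕ
occupied M L r = if L r <ᵇ M r then 1 else 0

rowsOf≡sumBelow : ∀ μ λ′ → rowsOf μ λ′ ≡ sumBelow (ℓ μ) (occupied (row μ) (row λ′))
rowsOf≡sumBelow μ λ′ = go id (ℓ μ)
  where
  go : ∀ f N → sum (map (occupied (row μ) (row λ′)) (applyUpTo f N)) ≡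
               sumBelow N (λ r → occupied (row μ) (row λ′) (f r))
  go f zero    = refl
  go f (suc N) = trans (cong (_+_ (occupied (row μ) (row λ′) (f 0))) (go (λ r → f (suc r)) N))
                       (sym (sumBelow-suc N _))

occupied-1 : ∀ M L {r} → L r < M r → occupied M L r ≡ 1
occupied-1 M L {r} L<M with L r <ᵇ M r | ℕ.<⇒<ᵇ L<M
... | true | _ = refl

occupied-0 : ∀ M L {r} → ¬ L r < M r → occupied M L r ≡ 0
occupied-0 M L {r} L≮M with L r <ᵇ M r in eq
... | true  = contradiction (ℕ.<ᵇ⇒< (L r) (M r) (subst T (sym eq) tt)) L≮M
... | false = refl

partsOf : ℕ → (ℕ → ℕ) → List ℕ
partsOf zero    f = []
partsOf (suc N) f with f 0
... | zero  = []
... | suc x = suc x ∷ partsOf N (λ r → f (suc r))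

rowLen-partsOf : ∀ N {f} → Decreasing f → (∀ r → N ≤ r → f r ≡ 0) → ∀ r → rowLen (partsOf N f) r ≡ f r
rowLen-partsOf zero    dec vanish r = sym (vanish r z≤n)
rowLen-partsOf (suc N) {f} dec vanish r with f 0 in eq
... | zero  = sym (ℕ.n≤0⇒n≡0 (subst (f r ≤_) eq (decreasing-antitone dec z≤n)))
rowLen-partsOf (suc N) dec vanish zero    | suc x = sym eq
rowLen-partsOf (suc N) dec vanish (suc r) | suc x =
  rowLen-partsOf N (λ r → dec (suc r)) (λ r N≤r → vanish (suc r) (s≤s N≤r)) r

partsOf-linked : ∀ N {f} x → Decreasing f → f 0 ≤ x → Linked (λ a b → b ≤ a) (x ∷ partsOf N f)
partsOf-linked zero    x dec f0≤x = [-]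
partsOf-linked (suc N) {f} x dec f0≤x with f 0 in eq
... | zero  = [-]
... | suc y = f0≤x ∷ partsOf-linked N (suc y) (λ r → dec (suc r)) (subst (f 1 ≤_) eq (dec 0))

partsOf-decreasing : ∀ N {f} → Decreasing f → Linked (λ a b → b ≤ a) (partsOf N f)
partsOf-decreasing zero    dec = []
partsOf-decreasing (suc N) {f} dec with f 0 in eq
... | zero  = []
... | suc x = partsOf-linked N (suc x) (λ r → dec (suc r)) (subst (f 1 ≤_) eq (dec 0))

partsOf-positive : ∀ N f → All (0 <_) (partsOf N f)
partsOf-positive zero    f = []
partsOf-positive (suc N) f with f 0
... | zero  = []
... | suc x = s≤s z≤n ∷ partsOf-positive N (λ r → f (suc r))

fromRows : ∀ N f → Decreasing f → Partition
fromRows N f dec = mkPartition (partsOf N f) (partsOf-decreasing N dec) (partsOf-positive N f)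

-- Beads

+-cancelʳ-<ℤ : ∀ {u v} w → u ℤ.+ w ℤ.< v ℤ.+ w → u ℤ.< v
+-cancelʳ-<ℤ {u} {v} w lt = subst₂ ℤ._<_ ([i+j]-j≡i w u) ([i+j]-j≡i w v) (ℤ.+-monoˡ-< (- w) lt)

diff-+ : ∀ A B D → + A ℤ.- + B ℤ.+ (+ B ℤ.+ + D) ≡ + (A + D)
diff-+ A B D = trans (lemma (+ A) (+ B) (+ D)) (sym (ℤ.pos-+ A D))
  where
  lemma : ∀ a b d → a ℤ.- b ℤ.+ (b ℤ.+ d) ≡ a ℤ.+ d
  lemma = ℤ-Ring.solve-∀

diff-+′ : ∀ C D B → + C ℤ.- + D ℤ.+ (+ B ℤ.+ + D) ≡ + (C + B)
diff-+′ C D B = trans (cong (λ x → + C ℤ.- + D ℤ.+ x) (ℤ.+-comm (+ B) (+ D))) (diff-+ C D B)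

diff<diff : ∀ A B C D → A + D < C + B → + A ℤ.- + B ℤ.< + C ℤ.- + D
diff<diff A B C D lt =
  +-cancelʳ-<ℤ (+ B ℤ.+ + D) (subst₂ ℤ._<_ (sym (diff-+ A B D)) (sym (diff-+′ C D B)) (ℤ.+<+ lt))

diff<diff⁻¹ : ∀ A B C D → + A ℤ.- + B ℤ.< + C ℤ.- + D → A + D < C + B
diff<diff⁻¹ A B C D lt =
  ℤ.drop‿+<+ (subst₂ ℤ._<_ (diff-+ A B D) (diff-+′ C D B) (ℤ.+-monoˡ-< (+ B ℤ.+ + D) lt))

diff≡diff : ∀ A B C D → A + D ≡ C + B → + A ℤ.- + B ≡ + C ℤ.- + D
diff≡diff A B C D eq =
  +-cancelʳ-≡ℤ (+ B ℤ.+ + D) _ _ (trans (diff-+ A B D) (trans (cong +_ eq) (sym (diff-+′ C D B))))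

diff≡diff⁻¹ : ∀ A B C D → + A ℤ.- + B ≡ + C ℤ.- + D → A + D ≡ C + B
diff≡diff⁻¹ A B C D eq =
  ℤ.+-injective (trans (sym (diff-+ A B D)) (trans (cong (ℤ._+ (+ B ℤ.+ + D)) eq) (diff-+′ C D B)))

-- The bead of row r: one position to the right of the diagonal of the last box of the row.
pos : (ℕ → ℕ) → ℕ → ℤ
pos f r = + f r ℤ.- + r

pos-cong : ∀ {m n} r → m ≡ n → + m ℤ.- + r ≡ + n ℤ.- + r
pos-cong r = cong (λ v → + v ℤ.- + r)

pos-suc : ∀ {m n} r → m ≡ suc n → + m ℤ.- + suc r ≡ + n ℤ.- + r
pos-suc {m} {n} r eq = diff≡diff m (suc r) n r (trans (cong (_+ r) eq) (sym (ℕ.+-suc n r)))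

pos-step : ∀ {f} → Decreasing f → ∀ r → pos f (suc r) ℤ.< pos f r
pos-step {f} dec r = diff<diff (f (suc r)) (suc r) (f r) r
  (subst (suc (f (suc r) + r) ≤_) (sym (ℕ.+-suc (f r) r)) (s≤s (ℕ.+-monoˡ-≤ r (dec r))))

pos-strict : ∀ {f} → Decreasing f → ∀ {r r′} → r < r′ → pos f r′ ℤ.< pos f r
pos-strict {f} dec {r} (s≤s r≤r′) with ℕ.m≤n⇒m<n∨m≡n r≤r′
... | inj₁ r<r′ = ℤ.<-trans (pos-step dec _) (pos-strict dec r<r′)
... | inj₂ refl = pos-step dec r

pos-antitone : ∀ {f} → Decreasing f → ∀ {r r′} → r ≤ r′ → pos f r′ ℤ.≤ pos f r
pos-antitone dec r≤r′ with ℕ.m≤n⇒m<n∨m≡n r≤r′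
... | inj₁ r<r′ = ℤ.<⇒≤ (pos-strict dec r<r′)
... | inj₂ refl = ℤ.≤-refl

pos-injective : ∀ {f} → Decreasing f → ∀ {r r′} → pos f r ≡ pos f r′ → r ≡ r′
pos-injective dec {r} {r′} eq with ℕ.<-cmp r r′
... | tri< r<r′ _ _ = contradiction (sym eq) (ℤ.<⇒≢ (pos-strict dec r<r′))
... | tri≈ _ r≡r′ _ = r≡r′
... | tri> _ _ r>r′ = contradiction eq (ℤ.<⇒≢ (pos-strict dec r>r′))

Bead : (ℕ → ℕ) → ℤ → Set
Bead f z = ∃ λ r → pos f r ≡ z

beads-determine-rows : ∀ {f g} → Decreasing f → Decreasing g →
  (∀ {z} → Bead f z → Bead g z) → (∀ {z} → Bead g z → Bead f z) → ∀ r → f r ≡ g r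
beads-determine-rows {f} {g} decf decg f⊆g g⊆f r =
  ℕ.+-cancelʳ-≡ r (f r) (g r) (diff≡diff⁻¹ (f r) r (g r) r (agree (suc r) r ℕ.≤-refl))
  where
  -- If the beads of the rows above r agree, the bead of row r of f is the bead of some row k ≥ r
  -- of g, so it does not lie right of the bead of row r of g.
  pos-≤ : ∀ {f g} → Decreasing f → Decreasing g → (∀ {z} → Bead f z → Bead g z) →
          ∀ r → (∀ r′ → r′ < r → pos f r′ ≡ pos g r′) → pos f r ℤ.≤ pos g r
  pos-≤ {f} {g} decf decg f⊆g r agree-before with f⊆g (r , refl)
  ... | k , gk≡fr with ℕ.<-cmp k r
  ... | tri< k<r _ _ = contradiction (pos-injective decf (trans (agree-before k k<r) gk≡fr)) (ℕ.<⇒≢ k<r)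
  ... | tri≈ _ refl _ = ℤ.≤-reflexive (sym gk≡fr)
  ... | tri> _ _ k>r = subst (ℤ._≤ pos g r) gk≡fr (pos-antitone decg (ℕ.<⇒≤ k>r))
  agree : ∀ n r → r < n → pos f r ≡ pos g r
  agree (suc n) r r<1+n with ℕ.m<1+n⇒m<n∨m≡n r<1+n
  ... | inj₁ r<n  = agree n r r<n
  ... | inj₂ refl = ℤ.≤-antisym (pos-≤ decf decg f⊆g r (agree r))
                                (pos-≤ decg decf g⊆f r (λ r′ r′<r → sym (agree r r′ r′<r)))

same-beads⇒same-rows : ∀ π π′ → (∀ {z} → Bead (row π) z → Bead (row π′) z) →
  (∀ {z} → Bead (row π′) z → Bead (row π) z) → ∀ r → row π r ≡ row π′ r
same-beads⇒same-rows π π′ = beads-determine-rows (row-decreasing π) (row-decreasing π′)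

record Move (S T : ℤ → Set) (p q : ℤ) : Set where
  field
    p∈S : S p
    q∉S : ¬ S q
    T⊆  : ∀ {z} → T z → (S z × z ≢ p) ⊎ z ≡ q
    ⊆T  : ∀ {z} → (S z × z ≢ p) ⊎ z ≡ q → T z

  keeps : ∀ {z} → S z → z ≢ p → T z
  keeps Sz z≢p = ⊆T (inj₁ (Sz , z≢p))

  q∈T : T q
  q∈T = ⊆T (inj₂ refl)

  p∉T : ¬ T p
  p∉T Tp with T⊆ Tp
  ... | inj₁ (_ , p≢p) = p≢p refl
  ... | inj₂ p≡q       = q∉S (subst S p≡q p∈S)

  stays-free : ∀ {z} → ¬ S z → z ≢ q → ¬ T z
  stays-free z∉S z≢q Tz with T⊆ Tz
  ... | inj₁ (Sz , _) = z∉S Sz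
  ... | inj₂ z≡q      = z≢q z≡q

Move-reverse : ∀ {S T p q} → Move S T p q → Move T S q p
Move-reverse {S} {T} {p} {q} mv = record
  { p∈S = q∈T
  ; q∉S = p∉T
  ; T⊆  = λ {z} Sz → case-S z Sz
  ; ⊆T  = λ { (inj₁ (Tz , z≢q)) → S-of-T Tz z≢q ; (inj₂ refl) → p∈S }
  }
  where
  open Move mv
  case-S : ∀ z → S z → (T z × z ≢ q) ⊎ z ≡ p
  case-S z Sz with z ℤ.≟ p
  ... | yes z≡p = inj₂ z≡p
  ... | no z≢p  = inj₁ (keeps Sz z≢p , λ z≡q → q∉S (subst S z≡q Sz))
  S-of-T : ∀ {z} → T z → z ≢ q → S z
  S-of-T Tz z≢q with T⊆ Tz
  ... | inj₁ (Sz , _) = Sz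
  ... | inj₂ z≡q      = contradiction z≡q z≢q

Move-independent : ∀ {S T₁ T₂ p₁ q₁ p₂ q₂} → Move S T₁ p₁ q₁ → Move S T₂ p₂ q₂ →
  p₁ ≢ p₂ → q₁ ≢ q₂ → T₁ p₂ × ¬ T₁ q₂
Move-independent mv₁ mv₂ p₁≢p₂ q₁≢q₂ =
  Move.keeps mv₁ (Move.p∈S mv₂) (λ p₂≡p₁ → p₁≢p₂ (sym p₂≡p₁)) ,
  Move.stays-free mv₁ (Move.q∉S mv₂) (λ q₂≡q₁ → q₁≢q₂ (sym q₂≡q₁))

Move-commute : ∀ {S T₁ T₂ U U′ p₁ q₁ p₂ q₂} →
  Move S T₁ p₁ q₁ → Move T₁ U p₂ q₂ → Move S T₂ p₂ q₂ → Move T₂ U′ p₁ q₁ → ∀ {z} → U z → U′ z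
Move-commute {S} mv₁ mv₁₂ mv₂ mv₂₁ {z} Uz with Move.T⊆ mv₁₂ Uz
... | inj₂ refl = Move.keeps mv₂₁ (Move.q∈T mv₂) (λ { refl → Move.q∉S mv₂ (Move.p∈S mv₁) })
... | inj₁ (T₁z , z≢p₂) with Move.T⊆ mv₁ T₁z
...   | inj₂ refl          = Move.q∈T mv₂₁
...   | inj₁ (Sz , z≢p₁)   = Move.keeps mv₂₁ (Move.keeps mv₂ Sz z≢p₂) z≢p₁

-- Ribbons as bead moves

data TailView (a s r : ℕ) : Set where
  tv-above  : r < a → TailView a s r
  tv-inside : ∀ k → k < s → r ≡ k + a → TailView a s r
  tv-tail   : r ≡ s + a → TailView a s r
  tv-below  : s + a < r → TailView a s r

tailView : ∀ a s r → TailView a s r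
tailView a s r with ℕ.<-cmp r a
... | tri< r<a _ _ = tv-above r<a
... | tri≈ _ refl _ = at-top s
  where
  at-top : ∀ s → TailView r s r
  at-top zero    = tv-tail refl
  at-top (suc s) = tv-inside zero (s≤s z≤n) refl
... | tri> _ _ r>a = beyond-top (r ∸ a) (sym (ℕ.m∸n+n≡m (ℕ.<⇒≤ r>a)))
  where
  beyond-top : ∀ k → r ≡ k + a → TailView a s r
  beyond-top k r≡k+a with ℕ.<-cmp k s
  ... | tri< k<s _ _ = tv-inside k k<s r≡k+a
  ... | tri≈ _ refl _ = tv-tail r≡k+a
  ... | tri> _ _ k>s = tv-below (subst (s + a <_) (sym r≡k+a) (ℕ.+-monoˡ-< a k>s))

data HeadView (a s r : ℕ) : Set where
  hv-above  : r < a → HeadView a s r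
  hv-head   : r ≡ a → HeadView a s r
  hv-inside : ∀ k → k < s → r ≡ suc (k + a) → HeadView a s r
  hv-below  : suc (s + a) ≤ r → HeadView a s r

headView : ∀ a s r → HeadView a s r
headView a s r with ℕ.<-cmp r a
... | tri< r<a _ _ = hv-above r<a
... | tri≈ _ r≡a _ = hv-head r≡a
headView a s (suc r) | tri> _ _ r≥a = beyond-top (r ∸ a) (sym (ℕ.m∸n+n≡m (ℕ.≤-pred r≥a)))
  where
  beyond-top : ∀ k → r ≡ k + a → HeadView a s (suc r)
  beyond-top k r≡k+a with ℕ.<-cmp k s
  ... | tri< k<s _ _ = hv-inside k k<s (cong suc r≡k+a)
  ... | tri≈ _ refl _ = hv-below (s≤s (ℕ.≤-reflexive (sym r≡k+a)))
  ... | tri> _ _ k>s = hv-below (s≤s (subst (s + a ≤_) (sym r≡k+a) (ℕ.+-monoˡ-≤ a (ℕ.<⇒≤ k>s))))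

-- M / L is a ribbon in the rows top, …, s + top: each of these rows but the first ends one column
-- further right than the row above it ends in L.  In bead terms, the bead of L at p moves to q.
record RibbonRows (M L : ℕ → ℕ) (p q : ℤ) (s : ℕ) : Set where
  field
    top      : ℕ
    above    : ∀ r → r < top → M r ≡ L r
    overhang : ∀ k → k < s → M (suc (k + top)) ≡ suc (L (k + top))
    below    : ∀ r → suc (s + top) ≤ r → M r ≡ L r
    head     : pos M top ≡ q
    tail     : pos L (s + top) ≡ p

  span : ℕ
  span = suc (s + top)

between : ℤ → ℤ → ℤ → ℕ
between p q z with p ℤ.<? z | z ℤ.<? q
... | yes _ | yes _ = 1
... | yes _ | no _  = 0
... | no _  | _     = 0

between-inside : ∀ {p q z} → p ℤ.< z → z ℤ.< q → between p q z ≡ 1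
between-inside {p} {q} {z} p<z z<q with p ℤ.<? z | z ℤ.<? q
... | yes _   | yes _   = refl
... | yes _   | no z≮q  = contradiction z<q z≮q
... | no p≮z  | _       = contradiction p<z p≮z

between-≤ : ∀ {p q z} → z ℤ.≤ p → between p q z ≡ 0
between-≤ {p} {q} {z} z≤p with p ℤ.<? z | z ℤ.<? q
... | yes p<z | yes _   = contradiction z≤p (ℤ.<⇒≱ p<z)
... | yes _   | no _    = refl
... | no _    | _       = refl

between-≥ : ∀ {p q z} → q ℤ.≤ z → between p q z ≡ 0
between-≥ {p} {q} {z} q≤z with p ℤ.<? z | z ℤ.<? q
... | yes _   | yes z<q = contradiction q≤z (ℤ.<⇒≱ z<q)
... | yes _   | no _    = refl
... | no _    | _       = refl

beadsBetween : ℤ → ℤ → (ℕ → ℕ) → ℕ → ℕ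
beadsBetween p q f N = sumBelow N (λ r → between p q (pos f r))

module RibbonRowsProperties {M L p q s} (rr : RibbonRows M L p q s)
  (decM : Decreasing M) (decL : Decreasing L) (p<q : p ℤ.< q) where

  open RibbonRows rr

  M-inside : ∀ k → k < s → pos M (suc (k + top)) ≡ pos L (k + top)
  M-inside k k<s = pos-suc (k + top) (overhang k k<s)

  L-above : ∀ r → r < top → q ℤ.< pos L r
  L-above r r<top = subst₂ ℤ._<_ head (pos-cong r (above r r<top)) (pos-strict decM r<top)

  L-inside-q : ∀ k → k < s → pos L (k + top) ℤ.< q
  L-inside-q k k<s = subst₂ ℤ._<_ (M-inside k k<s) head (pos-strict decM (s≤s (ℕ.m≤n+m top k)))

  L-inside-p : ∀ k → k < s → p ℤ.< pos L (k + top)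
  L-inside-p k k<s = subst (ℤ._< pos L (k + top)) tail (pos-strict decL (ℕ.+-monoˡ-< top k<s))

  L-below : ∀ r → s + top < r → pos L r ℤ.< p
  L-below r r>tail = subst (pos L r ℤ.<_) tail (pos-strict decL r>tail)

  M-above : ∀ r → r < top → q ℤ.< pos M r
  M-above r r<top = subst (ℤ._< pos M r) head (pos-strict decM r<top)

  M-below : ∀ r → span ≤ r → pos M r ℤ.< p
  M-below r span≤r = subst (ℤ._< p) (sym (pos-cong r (below r span≤r))) (L-below r span≤r)

  q∉L : ¬ Bead L q
  q∉L (r , Lr≡q) with tailView top s r
  ... | tv-above r<top        = ℤ.<⇒≢ (L-above r r<top) (sym Lr≡q)
  ... | tv-inside k k<s refl  = ℤ.<⇒≢ (L-inside-q k k<s) Lr≡q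
  ... | tv-tail refl          = ℤ.<⇒≢ p<q (trans (sym tail) Lr≡q)
  ... | tv-below r>tail       = ℤ.<⇒≢ (ℤ.<-trans (L-below r r>tail) p<q) Lr≡q

  M⊆ : ∀ {z} → Bead M z → (Bead L z × z ≢ p) ⊎ z ≡ q
  M⊆ (r , Mr≡z) with headView top s r
  ... | hv-above r<top = inj₁ ((r , trans (sym (pos-cong r (above r r<top))) Mr≡z) ,
                               λ { refl → ℤ.<⇒≢ (ℤ.<-trans p<q (M-above r r<top)) (sym Mr≡z) })
  ... | hv-head refl = inj₂ (trans (sym Mr≡z) head)
  ... | hv-inside k k<s refl = inj₁ ((k + top , trans (sym (M-inside k k<s)) Mr≡z) ,
                                     λ { refl → ℤ.<⇒≢ (L-inside-p k k<s) (trans (sym Mr≡z) (M-inside k k<s)) })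
  ... | hv-below span≤r = inj₁ ((r , trans (sym (pos-cong r (below r span≤r))) Mr≡z) ,
                               λ { refl → ℤ.<⇒≢ (M-below r span≤r) Mr≡z })

  ⊆M : ∀ {z} → (Bead L z × z ≢ p) ⊎ z ≡ q → Bead M z
  ⊆M (inj₂ refl) = top , head
  ⊆M (inj₁ ((r , Lr≡z) , z≢p)) with tailView top s r
  ... | tv-above r<top       = r , trans (pos-cong r (above r r<top)) Lr≡z
  ... | tv-inside k k<s refl = suc (k + top) , trans (M-inside k k<s) Lr≡z
  ... | tv-tail refl         = contradiction (trans (sym Lr≡z) tail) z≢p
  ... | tv-below r>tail      = r , trans (pos-cong r (below r r>tail)) Lr≡z

  move : Move (Bead L) (Bead M) p q
  move = record { p∈S = s + top , tail ; q∉S = q∉L ; T⊆ = M⊆ ; ⊆T = ⊆M }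

  sum-exchange : ∀ (f : ℤ → ℕ) N → span ≤ N →
    sumBelow N (λ r → f (pos M r)) + f p ≡ sumBelow N (λ r → f (pos L r)) + f q
  sum-exchange f N span≤N = begin
    sumBelow N (λ r → f (pos M r)) + f p
      ≡⟨ cong (_+_ (sumBelow N (λ r → f (pos M r)))) (cong f (sym tail)) ⟩
    sumBelow N (λ r → f (pos M r)) + f (pos L (s + top))
      ≡⟨ sumBelow-shift top s 0 N span≤N (λ r r<top → cong f (pos-cong r (above r r<top)))
           (λ k k<s → cong f (M-inside k k<s)) (λ r span≤r → cong f (pos-cong r (below r span≤r))) ⟩
    sumBelow N (λ r → f (pos L r)) + (f (pos M top) + s * 0)
      ≡⟨ cong (λ x → sumBelow N (λ r → f (pos L r)) + (x + s * 0)) (cong f head) ⟩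
    sumBelow N (λ r → f (pos L r)) + (f q + s * 0)
      ≡⟨ cong (λ x → sumBelow N (λ r → f (pos L r)) + (f q + x)) (ℕ.*-zeroʳ s) ⟩
    sumBelow N (λ r → f (pos L r)) + (f q + 0)
      ≡⟨ cong (_+_ (sumBelow N (λ r → f (pos L r)))) (ℕ.+-identityʳ (f q)) ⟩
    sumBelow N (λ r → f (pos L r)) + f q ∎

  spin≡beadsBetween : ∀ N → span ≤ N → beadsBetween p q L N ≡ s
  spin≡beadsBetween N span≤N = sumBelow-block top s N (ℕ.<⇒≤ span≤N)
    (λ r r<top → between-≥ (ℤ.<⇒≤ (L-above r r<top)))
    (λ k k<s → between-inside (L-inside-p k k<s) (L-inside-q k k<s))
    (λ r s+top≤r → between-≤ (subst (pos L r ℤ.≤_) tail (pos-antitone decL s+top≤r)))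

  p<pos-M : ∀ k → k ≤ s → p ℤ.< pos M (k + top)
  p<pos-M zero    _       = subst (p ℤ.<_) (sym head) p<q
  p<pos-M (suc k) k<s     = subst (p ℤ.<_) (sym (M-inside k k<s)) (L-inside-p k k<s)

  pos-L<pos-M : ∀ k → k ≤ s → pos L (k + top) ℤ.< pos M (k + top)
  pos-L<pos-M k k≤s with ℕ.m≤n⇒m<n∨m≡n k≤s
  ... | inj₁ k<s  = subst (ℤ._< pos M (k + top)) (M-inside k k<s) (pos-step decM (k + top))
  ... | inj₂ refl = subst (ℤ._< pos M (s + top)) (sym tail) (p<pos-M s ℕ.≤-refl)

  row-grows : ∀ k → k ≤ s → L (k + top) < M (k + top)
  row-grows k k≤s = ℕ.+-cancelʳ-< (k + top) (L (k + top)) (M (k + top))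
    (diff<diff⁻¹ (L (k + top)) (k + top) (M (k + top)) (k + top) (pos-L<pos-M k k≤s))

  L≤M : ∀ r → L r ≤ M r
  L≤M r with tailView top s r
  ... | tv-above r<top       = ℕ.≤-reflexive (sym (above r r<top))
  ... | tv-inside k k<s refl = ℕ.<⇒≤ (row-grows k (ℕ.<⇒≤ k<s))
  ... | tv-tail refl         = ℕ.<⇒≤ (row-grows s ℕ.≤-refl)
  ... | tv-below r>tail      = ℕ.≤-reflexive (sym (below r r>tail))

RibbonRows-congˡ : ∀ {M M′ L p q s} → (∀ r → M r ≡ M′ r) → RibbonRows M L p q s → RibbonRows M′ L p q s
RibbonRows-congˡ M≗M′ rr = record
  { top      = top
  ; above    = λ r r<top → trans (sym (M≗M′ r)) (above r r<top)
  ; overhang = λ k k<s → trans (sym (M≗M′ _)) (overhang k k<s)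
  ; below    = λ r span≤r → trans (sym (M≗M′ r)) (below r span≤r)
  ; head     = trans (sym (pos-cong top (M≗M′ top))) head
  ; tail     = tail
  }
  where open RibbonRows rr

RibbonRows-congʳ : ∀ {M L L′ p q s} → (∀ r → L r ≡ L′ r) → RibbonRows M L p q s → RibbonRows M L′ p q s
RibbonRows-congʳ {s = s} L≗L′ rr = record
  { top      = top
  ; above    = λ r r<top → trans (above r r<top) (L≗L′ r)
  ; overhang = λ k k<s → trans (overhang k k<s) (cong suc (L≗L′ _))
  ; below    = λ r span≤r → trans (below r span≤r) (L≗L′ r)
  ; head     = head
  ; tail     = trans (sym (pos-cong (s + top) (L≗L′ (s + top)))) tail
  }
  where open RibbonRows rr

module PartitionRibbon (μ λ′ : Partition) {p q s} (rr : RibbonRows (row μ) (row λ′) p q s)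
  (p<q : p ℤ.< q) where

  open RibbonRows rr public
  open RibbonRowsProperties rr (row-decreasing μ) (row-decreasing λ′) p<q public

  span≤ℓ : span ≤ ℓ μ
  span≤ℓ = row-positive⇒<ℓ μ (ℕ.≤-<-trans z≤n (row-grows s ℕ.≤-refl))

  ℓ≤ℓ : ℓ λ′ ≤ ℓ μ
  ℓ≤ℓ = ⊆⇒ℓ≤ {λ′} {μ} L≤M

record Least (P : ℕ → Set) : Set where
  field
    value   : ℕ
    holds   : P value
    minimal : ∀ r → r < value → ¬ P r

least : ∀ {P : ℕ → Set} → Decidable P → ∀ {n} → P n → Least P
least {P} P? {n} Pn = search 0 n refl (λ _ ())
  where
  search : ∀ k d → k + d ≡ n → (∀ r → r < k → ¬ P r) → Least P
  search k zero    k+0≡n ¬P<k = record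
    { value = k ; holds = subst P (trans (sym k+0≡n) (ℕ.+-identityʳ k)) Pn ; minimal = ¬P<k }
  search k (suc d) k+d≡n ¬P<k with P? k
  ... | yes Pk = record { value = k ; holds = Pk ; minimal = ¬P<k }
  ... | no ¬Pk = search (suc k) d (trans (sym (ℕ.+-suc k d)) k+d≡n) ¬P<1+k
    where
    ¬P<1+k : ∀ r → r < suc k → ¬ P r
    ¬P<1+k r r<1+k with ℕ.m<1+n⇒m<n∨m≡n r<1+k
    ... | inj₁ r<k  = ¬P<k r r<k
    ... | inj₂ refl = ¬Pk

row-reaching : ∀ A b {z} → + A ℤ.- + b ℤ.< z → ∃ λ m → (+ m ℤ.- + b ≡ z) × A < m
row-reaching A b {z} pos<z = ∣ z ℤ.+ + b ∣ , reaches , longer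
  where
  A<z+b : + A ℤ.< z ℤ.+ + b
  A<z+b = subst (ℤ._< z ℤ.+ + b) ([i-j]+j≡i (+ b) (+ A)) (ℤ.+-monoˡ-< (+ b) pos<z)
  z+b≥0 : 0ℤ ℤ.≤ z ℤ.+ + b
  z+b≥0 = ℤ.<⇒≤ (ℤ.≤-<-trans (ℤ.+≤+ z≤n) A<z+b)
  reaches : + ∣ z ℤ.+ + b ∣ ℤ.- + b ≡ z
  reaches = trans (cong (ℤ._- + b) (ℤ.0≤i⇒+∣i∣≡i z+b≥0)) ([i+j]-j≡i (+ b) z)
  longer : A < ∣ z ℤ.+ + b ∣
  longer = ℤ.drop‿+<+ (subst (+ A ℤ.<_) (sym (ℤ.0≤i⇒+∣i∣≡i z+b≥0)) A<z+b)

-- The ribbon starts in the first row whose bead lies left of q and ends in the row of the bead at p.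
-- Its first row is lengthened until its bead reaches q; every further row becomes one box longer
-- than the row above it was.
module AddRibbon (L : ℕ → ℕ) (decL : Decreasing L) (N : ℕ) (L-vanish : ∀ r → N ≤ r → L r ≡ 0)
  {p q : ℤ} (p<q : p ℤ.< q) (p∈L : Bead L p) (q∉L : ¬ Bead L q) where

  tailRow : ℕ
  tailRow = proj₁ p∈L

  top-search : Least (λ r → pos L r ℤ.< q)
  top-search = least (λ r → pos L r ℤ.<? q) {tailRow} (subst (ℤ._< q) (sym (proj₂ p∈L)) p<q)

  open Least top-search using () renaming (value to top; holds to pos-top<q)

  q<pos-above : ∀ r → r < top → q ℤ.< pos L r
  q<pos-above r r<top =
    ℤ.≤∧≢⇒< (ℤ.≮⇒≥ (Least.minimal top-search r r<top)) (λ q≡pos → q∉L (r , sym q≡pos))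

  top≤tailRow : top ≤ tailRow
  top≤tailRow = ℕ.≮⇒≥ λ tailRow<top →
    ℤ.<⇒≢ (ℤ.<-trans p<q (q<pos-above tailRow tailRow<top)) (sym (proj₂ p∈L))

  s : ℕ
  s = tailRow ∸ top

  reaching : ∃ λ m → (+ m ℤ.- + top ≡ q) × L top < m
  reaching = row-reaching (L top) top pos-top<q

  headLength : ℕ
  headLength = proj₁ reaching

  head-pos : + headLength ℤ.- + top ≡ q
  head-pos = proj₁ (proj₂ reaching)

  L<head : L top < headLength
  L<head = proj₂ (proj₂ reaching)

  M : ℕ → ℕ
  M r with headView top s r
  ... | hv-above _      = L r
  ... | hv-head _       = headLength
  ... | hv-inside k _ _ = suc (L (k + top))
  ... | hv-below _      = L r

  M-above : ∀ r → r < top → M r ≡ L r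
  M-above r r<top with headView top s r
  ... | hv-above _         = refl
  ... | hv-head refl       = contradiction r<top (ℕ.<-irrefl refl)
  ... | hv-inside k _ refl = contradiction r<top (ℕ.<⇒≯ (s≤s (ℕ.m≤n+m top k)))
  ... | hv-below span≤r    = contradiction r<top (ℕ.<⇒≯ (ℕ.<-≤-trans (s≤s (ℕ.m≤n+m top s)) span≤r))

  M-head : M top ≡ headLength
  M-head with headView top s top
  ... | hv-above top<top   = contradiction top<top (ℕ.<-irrefl refl)
  ... | hv-head _          = refl
  ... | hv-inside k _ eq   = contradiction eq (ℕ.<⇒≢ (s≤s (ℕ.m≤n+m top k)))
  ... | hv-below span≤top  = contradiction span≤top (ℕ.<⇒≱ (s≤s (ℕ.m≤n+m top s)))

  M-inside : ∀ k → k < s → M (suc (k + top)) ≡ suc (L (k + top))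
  M-inside k k<s with headView top s (suc (k + top))
  ... | hv-above r<top     = contradiction r<top (ℕ.<⇒≯ (s≤s (ℕ.m≤n+m top k)))
  ... | hv-head eq         = contradiction (sym eq) (ℕ.<⇒≢ (s≤s (ℕ.m≤n+m top k)))
  ... | hv-inside _ _ eq   = cong (λ r → suc (L r)) (ℕ.suc-injective (sym eq))
  ... | hv-below span≤r    = contradiction k<s (ℕ.≤⇒≯ (ℕ.+-cancelʳ-≤ top s k (ℕ.≤-pred span≤r)))

  M-below : ∀ r → suc (s + top) ≤ r → M r ≡ L r
  M-below r span≤r with headView top s r
  ... | hv-above r<top       = contradiction r<top (ℕ.<⇒≯ (ℕ.<-≤-trans (s≤s (ℕ.m≤n+m top s)) span≤r))
  ... | hv-head refl         = contradiction span≤r (ℕ.<⇒≱ (s≤s (ℕ.m≤n+m r s)))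
  ... | hv-inside k k<s refl = contradiction k<s (ℕ.≤⇒≯ (ℕ.+-cancelʳ-≤ top s k (ℕ.≤-pred span≤r)))
  ... | hv-below _           = refl

  L≤M : ∀ r → L r ≤ M r
  L≤M r = by-view (headView top s r)
    where
    by-view : HeadView top s r → L r ≤ M r
    by-view (hv-above r<top)       = ℕ.≤-reflexive (sym (M-above r r<top))
    by-view (hv-head refl)         = subst (L r ≤_) (sym M-head) (ℕ.<⇒≤ L<head)
    by-view (hv-inside k k<s refl) = subst (L r ≤_) (sym (M-inside k k<s)) (ℕ.m≤n⇒m≤1+n (decL (k + top)))
    by-view (hv-below span≤r)      = ℕ.≤-reflexive (sym (M-below r span≤r))

  head≤above : ∀ r → suc r ≡ top → headLength ≤ L r
  head≤above r 1+r≡top = ℕ.+-cancelʳ-≤ r headLength (L r) (ℕ.≤-pred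
    (subst (suc (headLength + r) ≤_) (ℕ.+-suc (L r) r) (diff<diff⁻¹ headLength (suc r) (L r) r head<above)))
    where
    head<above : + headLength ℤ.- + suc r ℤ.< pos L r
    head<above = subst (λ t → + headLength ℤ.- + t ℤ.< pos L r) (sym 1+r≡top)
      (subst (ℤ._< pos L r) (sym head-pos) (q<pos-above r (subst (r <_) 1+r≡top ℕ.≤-refl)))

  1+L≤M : ∀ k → k ≤ s → suc (L (k + top)) ≤ M (k + top)
  1+L≤M zero    _   = subst (suc (L top) ≤_) (sym M-head) L<head
  1+L≤M (suc k) k<s = subst (suc (L (suc k + top)) ≤_) (sym (M-inside k k<s)) (s≤s (decL (k + top)))

  decM : Decreasing M
  decM r = by-view (headView top s (suc r))
    where
    by-view : HeadView top s (suc r) → M (suc r) ≤ M r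
    by-view (hv-above 1+r<top) =
      subst₂ _≤_ (sym (M-above (suc r) 1+r<top)) (sym (M-above r (ℕ.<-trans (ℕ.n<1+n r) 1+r<top))) (decL r)
    by-view (hv-head 1+r≡top) =
      subst₂ _≤_ (sym (trans (cong M 1+r≡top) M-head)) (sym (M-above r (subst (r <_) 1+r≡top (ℕ.n<1+n r))))
        (head≤above r 1+r≡top)
    by-view (hv-inside k k<s refl) =
      subst (_≤ M (k + top)) (sym (M-inside k k<s)) (1+L≤M k (ℕ.<⇒≤ k<s))
    by-view (hv-below span≤1+r) =
      subst (_≤ M r) (sym (M-below (suc r) span≤1+r)) (ℕ.≤-trans (decL r) (L≤M r))

  bound : ℕ
  bound = N + suc (s + top)

  M-vanish : ∀ r → bound ≤ r → M r ≡ 0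
  M-vanish r bound≤r =
    trans (M-below r (ℕ.≤-trans (ℕ.m≤n+m _ N) bound≤r)) (L-vanish r (ℕ.≤-trans (ℕ.m≤m+n N _) bound≤r))

  ribbonRows : RibbonRows M L p q s
  ribbonRows = record
    { top      = top
    ; above    = M-above
    ; overhang = M-inside
    ; below    = M-below
    ; head     = trans (pos-cong top M-head) head-pos
    ; tail     = trans (cong (pos L) (ℕ.m∸n+n≡m top≤tailRow)) (proj₂ p∈L)
    }

∣i∣≤n⇒-[1+n]<i : ∀ {K} z → ∣ z ∣ ≤ K → -[1+ K ] ℤ.< z
∣i∣≤n⇒-[1+n]<i (+ n)    _      = ℤ.-<+
∣i∣≤n⇒-[1+n]<i -[1+ n ] n<1+K  = ℤ.-<- n<1+K

-- The inverse construction: the ribbon starts in the row of the bead at q and ends just above the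
-- first row whose bead lies left of p.  Its last row is shortened until its bead reaches p; every
-- other row becomes one box shorter than the row below it.
module RemoveRibbon (M : ℕ → ℕ) (decM : Decreasing M) (N : ℕ) (M-vanish : ∀ r → N ≤ r → M r ≡ 0)
  {p q : ℤ} (p<q : p ℤ.< q) (q∈M : Bead M q) (p∉M : ¬ Bead M p) where

  top : ℕ
  top = proj₁ q∈M

  -- Beyond the partition pos M r = − r, so this row's bead lies left of p.
  far : ℕ
  far = suc (N + ∣ p ∣)

  pos-far<p : pos M far ℤ.< p
  pos-far<p = subst (ℤ._< p) (sym (pos-cong far (M-vanish far (ℕ.m≤n⇒m≤1+n (ℕ.m≤m+n N ∣ p ∣)))))
    (∣i∣≤n⇒-[1+n]<i p (ℕ.m≤n+m ∣ p ∣ N))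

  bottom-search : Least (λ r → pos M r ℤ.< p)
  bottom-search = least (λ r → pos M r ℤ.<? p) {far} pos-far<p

  open Least bottom-search using () renaming (value to bottom; holds to pos-bottom<p)

  p<pos-above : ∀ r → r < bottom → p ℤ.< pos M r
  p<pos-above r r<bottom =
    ℤ.≤∧≢⇒< (ℤ.≮⇒≥ (Least.minimal bottom-search r r<bottom)) (λ p≡pos → p∉M (r , sym p≡pos))

  top<bottom : top < bottom
  top<bottom = ℕ.≰⇒> λ bottom≤top → ℤ.<-asym p<q
    (subst (ℤ._< p) (proj₂ q∈M) (ℤ.≤-<-trans (pos-antitone decM bottom≤top) pos-bottom<p))

  s : ℕ
  s = bottom ∸ suc top

  bottom≡ : bottom ≡ suc (s + top)
  bottom≡ = trans (sym (ℕ.m∸n+n≡m top<bottom)) (ℕ.+-suc s top)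

  reaching : ∃ λ m → (+ m ℤ.- + bottom ≡ p) × M bottom < m
  reaching = row-reaching (M bottom) bottom pos-bottom<p

  tailLength : ℕ
  tailLength = pred (proj₁ reaching)

  M-bottom<reach : M bottom < proj₁ reaching
  M-bottom<reach = proj₂ (proj₂ reaching)

  suc-tail : suc tailLength ≡ proj₁ reaching
  suc-tail = ℕ.suc-pred (proj₁ reaching) {{ℕ.>-nonZero (ℕ.≤-<-trans z≤n M-bottom<reach)}}

  tail-pos : + tailLength ℤ.- + (s + top) ≡ p
  tail-pos = trans (diff≡diff tailLength (s + top) (proj₁ reaching) bottom shifted) (proj₁ (proj₂ reaching))
    where
    shifted : tailLength + bottom ≡ proj₁ reaching + (s + top)
    shifted = trans (cong (_+_ tailLength) bottom≡)
      (trans (ℕ.+-suc tailLength (s + top)) (cong (_+ (s + top)) suc-tail))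

  M-bottom≤tail : M bottom ≤ tailLength
  M-bottom≤tail = ℕ.≤-pred (subst (M bottom <_) (sym suc-tail) M-bottom<reach)

  tail<M : tailLength < M (s + top)
  tail<M = ℕ.+-cancelʳ-< (s + top) tailLength (M (s + top))
    (diff<diff⁻¹ tailLength (s + top) (M (s + top)) (s + top)
      (subst (ℤ._< pos M (s + top)) (sym tail-pos)
        (p<pos-above (s + top) (subst (s + top <_) (sym bottom≡) ℕ.≤-refl))))

  L : ℕ → ℕ
  L r with tailView top s r
  ... | tv-above _      = M r
  ... | tv-inside k _ _ = pred (M (suc (k + top)))
  ... | tv-tail _       = tailLength
  ... | tv-below _      = M r

  L-above : ∀ r → r < top → L r ≡ M r
  L-above r r<top with tailView top s r
  ... | tv-above _         = refl
  ... | tv-inside k _ refl = contradiction r<top (ℕ.≤⇒≯ (ℕ.m≤n+m top k))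
  ... | tv-tail refl       = contradiction r<top (ℕ.≤⇒≯ (ℕ.m≤n+m top s))
  ... | tv-below r>tail    = contradiction r<top (ℕ.≤⇒≯ (ℕ.≤-trans (ℕ.m≤n+m top s) (ℕ.<⇒≤ r>tail)))

  L-inside : ∀ k → k < s → L (k + top) ≡ pred (M (suc (k + top)))
  L-inside k k<s with tailView top s (k + top)
  ... | tv-above r<top      = contradiction r<top (ℕ.≤⇒≯ (ℕ.m≤n+m top k))
  ... | tv-inside _ _ eq    = cong (λ r → pred (M (suc r))) (sym eq)
  ... | tv-tail eq          = contradiction (ℕ.+-cancelʳ-≡ top k s eq) (ℕ.<⇒≢ k<s)
  ... | tv-below r>tail     = contradiction k<s (ℕ.<⇒≯ (ℕ.+-cancelʳ-< top s k r>tail))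

  L-tail : L (s + top) ≡ tailLength
  L-tail with tailView top s (s + top)
  ... | tv-above r<top      = contradiction r<top (ℕ.≤⇒≯ (ℕ.m≤n+m top s))
  ... | tv-inside k k<s eq  = contradiction (sym (ℕ.+-cancelʳ-≡ top s k eq)) (ℕ.<⇒≢ k<s)
  ... | tv-tail _           = refl
  ... | tv-below r>tail     = contradiction r>tail (ℕ.<-irrefl refl)

  L-below : ∀ r → s + top < r → L r ≡ M r
  L-below r r>tail with tailView top s r
  ... | tv-above r<top       = contradiction r<top (ℕ.≤⇒≯ (ℕ.≤-trans (ℕ.m≤n+m top s) (ℕ.<⇒≤ r>tail)))
  ... | tv-inside k k<s refl = contradiction k<s (ℕ.<⇒≯ (ℕ.+-cancelʳ-< top s k r>tail))
  ... | tv-tail refl         = contradiction r>tail (ℕ.<-irrefl refl)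
  ... | tv-below _           = refl

  M-inside-positive : ∀ k → k < s → 0 < M (suc (k + top))
  M-inside-positive k k<s =
    ℕ.≤-<-trans z≤n (ℕ.<-≤-trans tail<M (decreasing-antitone decM (ℕ.+-monoˡ-≤ top k<s)))

  L<M-inside : ∀ k → k ≤ s → L (k + top) < M (k + top)
  L<M-inside k k≤s with ℕ.m≤n⇒m<n∨m≡n k≤s
  ... | inj₁ k<s  =
    subst (_< M (k + top)) (sym (L-inside k k<s)) (pred< (M-inside-positive k k<s) (decM (k + top)))
    where
    pred< : ∀ {m n} → 0 < m → m ≤ n → pred m < n
    pred< {suc m} _ m<n = m<n
  ... | inj₂ refl = subst (_< M (s + top)) (sym L-tail) tail<M

  L≤M : ∀ r → L r ≤ M r
  L≤M r = by-view (tailView top s r)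
    where
    by-view : TailView top s r → L r ≤ M r
    by-view (tv-above r<top)       = ℕ.≤-reflexive (L-above r r<top)
    by-view (tv-inside k k<s refl) = ℕ.<⇒≤ (L<M-inside k (ℕ.<⇒≤ k<s))
    by-view (tv-tail refl)         = ℕ.<⇒≤ (L<M-inside s ℕ.≤-refl)
    by-view (tv-below r>tail)      = ℕ.≤-reflexive (L-below r r>tail)

  decL : Decreasing L
  decL r = by-view (tailView top s r)
    where
    by-view : TailView top s r → L (suc r) ≤ L r
    by-view (tv-above r<top) =
      subst (L (suc r) ≤_) (sym (L-above r r<top)) (ℕ.≤-trans (L≤M (suc r)) (decM r))
    by-view (tv-inside k k<s refl) =
      subst (L (suc k + top) ≤_) (sym (L-inside k k<s)) (ℕ.<⇒≤pred (L<M-inside (suc k) k<s))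
    by-view (tv-tail refl) =
      subst₂ _≤_ (sym (L-below (suc (s + top)) ℕ.≤-refl)) (sym L-tail)
        (subst (λ r → M r ≤ tailLength) bottom≡ M-bottom≤tail)
    by-view (tv-below r>tail) =
      subst₂ _≤_ (sym (L-below (suc r) (ℕ.m≤n⇒m≤1+n r>tail))) (sym (L-below r r>tail)) (decM r)

  bound : ℕ
  bound = N + suc (s + top)

  L-vanish : ∀ r → bound ≤ r → L r ≡ 0
  L-vanish r bound≤r =
    trans (L-below r (ℕ.≤-trans (ℕ.m≤n+m _ N) bound≤r)) (M-vanish r (ℕ.≤-trans (ℕ.m≤m+n N _) bound≤r))

  ribbonRows : RibbonRows M L p q s
  ribbonRows = record
    { top      = top
    ; above    = λ r r<top → sym (L-above r r<top)
    ; overhang = λ k k<s →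
        trans (sym (ℕ.suc-pred _ {{ℕ.>-nonZero (M-inside-positive k k<s)}})) (cong suc (sym (L-inside k k<s)))
    ; below    = λ r r>tail → sym (L-below r r>tail)
    ; head     = proj₂ q∈M
    ; tail     = trans (pos-cong (s + top) L-tail) tail-pos
    }

addRibbon : ∀ λ′ {p q} → p ℤ.< q → Bead (row λ′) p → ¬ Bead (row λ′) q →
  Σ Partition λ ρ → Σ ℕ λ s → RibbonRows (row ρ) (row λ′) p q s
addRibbon λ′ p<q p∈λ q∉λ =
  fromRows bound M decM , s ,
  RibbonRows-congˡ (λ r → sym (rowLen-partsOf bound decM M-vanish r)) ribbonRows
  where open AddRibbon (row λ′) (row-decreasing λ′) (ℓ λ′) (λ r → row-beyond λ′) p<q p∈λ q∉λ

removeRibbon : ∀ μ {p q} → p ℤ.< q → Bead (row μ) q → ¬ Bead (row μ) p →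
  Σ Partition λ ν → Σ ℕ λ s → RibbonRows (row μ) (row ν) p q s
removeRibbon μ p<q q∈μ p∉μ =
  fromRows bound L decL , s ,
  RibbonRows-congʳ (λ r → sym (rowLen-partsOf bound decL L-vanish r)) ribbonRows
  where open RemoveRibbon (row μ) (row-decreasing μ) (ℓ μ) (λ r → row-beyond μ) p<q q∈μ p∉μ

-- Ribbons as skew shapes

Adj-sym : ∀ {b b′} → Adj b b′ → Adj b′ b
Adj-sym right = left
Adj-sym left  = right
Adj-sym down  = up
Adj-sym up    = down

Path-++ : ∀ {μ λ′ b b′ b″} → Path μ λ′ b b′ → Path μ λ′ b′ b″ → Path μ λ′ b b″
Path-++ here                 π = π
Path-++ (step adj b′∈ π₁) π₂ = step adj b′∈ (Path-++ π₁ π₂)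

Path-reverse : ∀ {μ λ′ b b′} → InSkew μ λ′ b → Path μ λ′ b b′ → Path μ λ′ b′ b
Path-reverse b∈ π = go b∈ π here
  where
  go : ∀ {μ λ′ b b′ b₀} → InSkew μ λ′ b → Path μ λ′ b b′ → Path μ λ′ b b₀ → Path μ λ′ b′ b₀
  go b∈ here                 acc = acc
  go b∈ (step adj b′∈ π)     acc = go b′∈ π (step (Adj-sym adj) b∈ acc)

beadTo : ℤ → ℤ
beadTo i = i ℤ.+ 1ℤ

beadFrom : ℤ → ℕ → ℤ
beadFrom i n = beadTo i ℤ.- + n

beadFrom<beadTo : ∀ i {n} → 1 ≤ n → beadFrom i n ℤ.< beadTo i
beadFrom<beadTo i {n} 1≤n = subst₂ ℤ._<_ (ℤ.+-identityʳ (beadFrom i n)) ([i-j]+j≡i (+ n) (beadTo i))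
  (ℤ.+-monoʳ-< (beadFrom i n) (ℤ.+<+ 1≤n))

beadFrom≡ : ∀ {A a} i n → + A ℤ.- + a ≡ beadTo i → beadFrom i n ≡ + A ℤ.- + (a + n)
beadFrom≡ {A} {a} i n head = begin
  beadTo i ℤ.- + n               ≡⟨ cong (ℤ._- + n) (sym head) ⟩
  + A ℤ.- + a ℤ.- + n            ≡⟨ regroup (+ A) (+ a) (+ n) ⟩
  + A ℤ.- (+ a ℤ.+ + n)          ≡⟨ cong (λ x → + A ℤ.- x) (sym (ℤ.pos-+ a n)) ⟩
  + A ℤ.- + (a + n)              ∎
  where
  regroup : ∀ x y z → x ℤ.- y ℤ.- z ≡ x ℤ.- (y ℤ.+ z)
  regroup = ℤ-Ring.solve-∀

pos≡diag+1 : ∀ a {c m} → suc c ≡ m → + m ℤ.- + a ≡ diag (a , c) ℤ.+ 1ℤ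
pos≡diag+1 a {c} refl = swap (+ c) (+ a)
  where
  swap : ∀ u v → 1ℤ ℤ.+ u ℤ.- v ≡ u ℤ.- v ℤ.+ 1ℤ
  swap = ℤ-Ring.solve-∀

module RibbonSize (μ λ′ : Partition) (top s : ℕ) (span≤ℓ : suc (s + top) ≤ ℓ μ) (ℓλ≤ℓμ : ℓ λ′ ≤ ℓ μ)
  (above : ∀ r → r < top → row μ r ≡ row λ′ r)
  (overhang : ∀ k → k < s → row μ (suc (k + top)) ≡ suc (row λ′ (k + top)))
  (below : ∀ r → suc (s + top) ≤ r → row μ r ≡ row λ′ r)
  {i} (head : pos (row μ) top ≡ beadTo i) (n : ℕ) where

  private
    L′ Mt : ℕ
    L′ = row λ′ (s + top)
    Mt = row μ top

  size-balance : size μ + L′ ≡ size λ′ + (Mt + s)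
  size-balance = begin
    size μ + L′                         ≡⟨ cong (_+ L′) (size≡sumBelow μ ℕ.≤-refl) ⟩
    sumBelow (ℓ μ) (row μ) + L′         ≡⟨ sumBelow-shift top s 1 (ℓ μ) span≤ℓ above overhang below ⟩
    sumBelow (ℓ μ) (row λ′) + (Mt + s * 1)
      ≡⟨ cong₂ (λ x y → x + (Mt + y)) (sym (size≡sumBelow λ′ ℓλ≤ℓμ)) (ℕ.*-identityʳ s) ⟩
    size λ′ + (Mt + s)                  ∎

  tail⇒gap : pos (row λ′) (s + top) ≡ beadFrom i n → L′ + (top + n) ≡ Mt + (s + top)
  tail⇒gap tail = diff≡diff⁻¹ L′ (s + top) Mt (top + n) (trans tail (beadFrom≡ {Mt} {top} i n head))

  gap⇒tail : L′ + (top + n) ≡ Mt + (s + top) → pos (row λ′) (s + top) ≡ beadFrom i n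
  gap⇒tail gap = trans (diff≡diff L′ (s + top) Mt (top + n) gap) (sym (beadFrom≡ {Mt} {top} i n head))

  tail⇒size : pos (row λ′) (s + top) ≡ beadFrom i n → size μ ≡ size λ′ + n
  tail⇒size tail = ℕ.+-cancelʳ-≡ (L′ + top) (size μ) (size λ′ + n) (begin
    size μ + (L′ + top)          ≡⟨ ℕ.+-assoc (size μ) L′ top ⟨
    size μ + L′ + top            ≡⟨ cong (_+ top) size-balance ⟩
    size λ′ + (Mt + s) + top     ≡⟨ regroup (size λ′) Mt s top ⟩
    size λ′ + (Mt + (s + top))   ≡⟨ cong (_+_ (size λ′)) (sym (tail⇒gap tail)) ⟩
    size λ′ + (L′ + (top + n))   ≡⟨ regroup′ (size λ′) L′ top n ⟩
    size λ′ + n + (L′ + top)     ∎)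
    where
    regroup : ∀ a b c d → a + (b + c) + d ≡ a + (b + (c + d))
    regroup = ℕ-Ring.solve-∀
    regroup′ : ∀ a b c d → a + (b + (c + d)) ≡ a + d + (b + c)
    regroup′ = ℕ-Ring.solve-∀

  size⇒tail : size μ ≡ size λ′ + n → pos (row λ′) (s + top) ≡ beadFrom i n
  size⇒tail size≡ = gap⇒tail (begin
    L′ + (top + n)               ≡⟨ regroup L′ top n ⟩
    n + L′ + top                 ≡⟨ cong (_+ top) (ℕ.+-cancelˡ-≡ (size λ′) (n + L′) (Mt + s) (begin
      size λ′ + (n + L′)           ≡⟨ ℕ.+-assoc (size λ′) n L′ ⟨
      size λ′ + n + L′             ≡⟨ cong (_+ L′) (sym size≡) ⟩
      size μ + L′                  ≡⟨ size-balance ⟩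
      size λ′ + (Mt + s)           ∎)) ⟩
    Mt + s + top                 ≡⟨ ℕ.+-assoc Mt s top ⟩
    Mt + (s + top)               ∎)
    where
    regroup : ∀ a b c → a + (b + c) ≡ c + a + b
    regroup = ℕ-Ring.solve-∀

module RibbonRows⇒Ribbon {n μ λ′ i s} (1≤n : 1 ≤ n)
  (rr : RibbonRows (row μ) (row λ′) (beadFrom i n) (beadTo i) s) where

  open PartitionRibbon μ λ′ rr (beadFrom<beadTo i 1≤n)

  M L : ℕ → ℕ
  M = row μ
  L = row λ′

  in-ribbon-rows : ∀ {r c} → InSkew μ λ′ (r , c) → ∃ λ k → k ≤ s × r ≡ k + top
  in-ribbon-rows {r} {c} (c<M , c≮L) with tailView top s r
  ... | tv-above r<top       = contradiction (subst (c <_) (above r r<top) c<M) c≮L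
  ... | tv-inside k k<s r≡   = k , ℕ.<⇒≤ k<s , r≡
  ... | tv-tail r≡           = s , ℕ.≤-refl , r≡
  ... | tv-below r>tail      = contradiction (subst (c <_) (below r r>tail) c<M) c≮L

  along-row : ∀ r c d → L r ≤ c → d + c < M r → Path μ λ′ (r , c) (r , d + c)
  along-row r c zero    _    _         = here
  along-row r c (suc d) L≤c 1+d+c<M =
    step right next∈ (subst (λ t → Path μ λ′ (r , suc c) (r , t)) (ℕ.+-suc d c)
      (along-row r (suc c) d (ℕ.m≤n⇒m≤1+n L≤c) (subst (_< M r) (sym (ℕ.+-suc d c)) 1+d+c<M)))
    where
    next∈ : InSkew μ λ′ (r , suc c)
    next∈ = ℕ.≤-<-trans (s≤s (ℕ.m≤n+m c d)) 1+d+c<M , ℕ.≤⇒≯ (ℕ.m≤n⇒m≤1+n L≤c)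

  to-row-end : ∀ r c → L r ≤ c → c < M r → Path μ λ′ (r , c) (r , pred (M r))
  to-row-end r c L≤c c<M = subst (λ t → Path μ λ′ (r , c) (r , t)) (ℕ.m∸n+n≡m c≤end)
    (along-row r c (pred (M r) ∸ c) L≤c (subst (_< M r) (sym (ℕ.m∸n+n≡m c≤end)) end<M))
    where
    c≤end : c ≤ pred (M r)
    c≤end = ℕ.<⇒≤pred c<M
    end<M : pred (M r) < M r
    end<M = ℕ.≤-reflexive (ℕ.suc-pred (M r) {{ℕ.>-nonZero (ℕ.≤-<-trans z≤n c<M)}})

  end : ℕ
  end = pred (M top)

  suc-end : suc end ≡ M top
  suc-end = ℕ.suc-pred (M top) {{ℕ.>-nonZero (ℕ.≤-<-trans z≤n (row-grows 0 z≤n))}}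

  headBox : Box
  headBox = top , end

  -- The last box of row k + 1 + top lies right below the first box of row k + top in the ribbon.
  to-head : ∀ k → k ≤ s → ∀ c → L (k + top) ≤ c → c < M (k + top) → Path μ λ′ (k + top , c) headBox
  to-head zero    _   c L≤c c<M = to-row-end top c L≤c c<M
  to-head (suc k) k<s c L≤c c<M = Path-++
    (subst (λ t → Path μ λ′ (suc k + top , c) (suc k + top , t)) (cong pred (overhang k k<s))
      (to-row-end (suc k + top) c L≤c c<M))
    (step up (row-grows k (ℕ.<⇒≤ k<s) , ℕ.<-irrefl refl)
      (to-head k (ℕ.<⇒≤ k<s) (L (k + top)) ℕ.≤-refl (row-grows k (ℕ.<⇒≤ k<s))))

  path-to-head : ∀ {b} → InSkew μ λ′ b → Path μ λ′ b headBox
  path-to-head {r , c} b∈@(c<M , c≮L) with in-ribbon-rows b∈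
  ... | k , k≤s , refl = to-head k k≤s c (ℕ.≮⇒≥ c≮L) c<M

  connected : Connected μ λ′
  connected b b′ b∈ b′∈ = Path-++ (path-to-head b∈) (Path-reverse b′∈ (path-to-head b′∈))

  no2x2 : No2x2 μ λ′
  no2x2 (r , c , b₁ , _ , _ , b₄) with in-ribbon-rows b₁ | in-ribbon-rows b₄
  ... | k , _ , refl | k′ , k′≤s , 1+k+top≡ =
    proj₂ b₁ (ℕ.≤-pred (subst (suc c <_) (overhang k k<s) (proj₁ b₄)))
    where
    k<s : k < s
    k<s = subst (_≤ s) (ℕ.+-cancelʳ-≡ top k′ (suc k) (sym 1+k+top≡)) k′≤s

  headBox∈ : InSkew μ λ′ headBox
  headBox∈ = ℕ.≤-reflexive suc-end , ℕ.≤⇒≯ (ℕ.<⇒≤pred (row-grows 0 z≤n))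

  headOn : HeadOn μ λ′ i
  headOn = headBox , headBox∈ , on-diagonal , topmost
    where
    on-diagonal : diag headBox ≡ i
    on-diagonal = +-cancelʳ-≡ℤ 1ℤ (diag headBox) i (trans (sym (pos≡diag+1 top suc-end)) head)
    topmost : ∀ b → InSkew μ λ′ b → (top ≤ proj₁ b) × (proj₁ b ≡ top → proj₂ b ≤ end)
    topmost (r , c) b∈ with in-ribbon-rows b∈
    ... | k , _ , refl = ℕ.m≤n+m top k , λ r≡top → ℕ.<⇒≤pred (subst (λ t → c < M t) r≡top (proj₁ b∈))

  rowsOf≡ : rowsOf μ λ′ ≡ suc s
  rowsOf≡ = trans (rowsOf≡sumBelow μ λ′) (sumBelow-block top (suc s) (ℓ μ) span≤ℓ
    (λ r r<top → occupied-0 M L (λ L<M → ℕ.<-irrefl (sym (above r r<top)) L<M))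
    (λ k k≤s → occupied-1 M L (row-grows k (ℕ.≤-pred k≤s)))
    (λ r span≤r → occupied-0 M L (λ L<M → ℕ.<-irrefl (sym (below r span≤r)) L<M)))

  ribbon : Ribbon n μ λ′ i s
  ribbon = L≤M , tail⇒size tail , connected , no2x2 , headOn , rowsOf≡
    where open RibbonSize μ λ′ top s span≤ℓ ℓ≤ℓ above overhang below {i} head n

Path-crosses : ∀ {μ λ′ b b′} → Path μ λ′ b b′ → InSkew μ λ′ b → ∀ r → proj₁ b ≤ r → r < proj₁ b′ →
  ∃ λ c → InSkew μ λ′ (r , c) × InSkew μ λ′ (suc r , c)
Path-crosses here                         b∈ r b≤r r<b′ = contradiction b≤r (ℕ.<⇒≱ r<b′)
Path-crosses (step right b′∈ π)           _  r b≤r r<b′ = Path-crosses π b′∈ r b≤r r<b′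
Path-crosses (step left b′∈ π)            _  r b≤r r<b′ = Path-crosses π b′∈ r b≤r r<b′
Path-crosses (step up b′∈ π)              _  r b≤r r<b′ =
  Path-crosses π b′∈ r (ℕ.≤-trans (ℕ.n≤1+n _) b≤r) r<b′
Path-crosses (step {b = _ , c} down b′∈ π) b∈ r b≤r r<b′ with ℕ.m≤n⇒m<n∨m≡n b≤r
... | inj₁ b<r  = Path-crosses π b′∈ r b<r r<b′
... | inj₂ refl = c , b∈ , b′∈

-- Connectivity makes the occupied rows consecutive and makes neighbouring ones share a column;
-- the absence of 2 × 2 squares then fixes each overhang to exactly one box.
module Ribbon⇒RibbonRows {n μ λ′ i s} (λ⊆μ : λ′ ⊆ᴾ μ) (size≡ : size μ ≡ size λ′ + n) (conn : Connected μ λ′)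
  (no-2x2 : No2x2 μ λ′) (top c : ℕ) (head∈ : InSkew μ λ′ (top , c)) (on-diagonal : diag (top , c) ≡ i)
  (topmost : ∀ b → InSkew μ λ′ b → (top ≤ proj₁ b) × (proj₁ b ≡ top → proj₂ b ≤ c))
  (rows≡ : rowsOf μ λ′ ≡ suc s) where

  M L : ℕ → ℕ
  M = row μ
  L = row λ′

  Occupied : ℕ → Set
  Occupied r = L r < M r

  first-box : ∀ {r} → Occupied r → InSkew μ λ′ (r , L r)
  first-box occ = occ , ℕ.<-irrefl refl

  box⇒occupied : ∀ {r c} → InSkew μ λ′ (r , c) → Occupied r
  box⇒occupied (c<M , c≮L) = ℕ.≤-<-trans (ℕ.≮⇒≥ c≮L) c<M

  crossing : ∀ {r₁ r₂} → Occupied r₁ → Occupied r₂ → ∀ r → r₁ ≤ r → r < r₂ →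
    ∃ λ c → InSkew μ λ′ (r , c) × InSkew μ λ′ (suc r , c)
  crossing {r₁} {r₂} occ₁ occ₂ =
    Path-crosses (conn (r₁ , L r₁) (r₂ , L r₂) (first-box occ₁) (first-box occ₂)) (first-box occ₁)

  top-occupied : Occupied top
  top-occupied = box⇒occupied head∈

  suc-c : suc c ≡ M top
  suc-c = ℕ.≤-antisym (proj₁ head∈)
    (subst (_≤ suc c) suc-pred (s≤s (proj₂ (topmost (top , pred (M top)) last∈) refl)))
    where
    suc-pred : suc (pred (M top)) ≡ M top
    suc-pred = ℕ.suc-pred (M top) {{ℕ.>-nonZero (ℕ.≤-<-trans z≤n top-occupied)}}
    last∈ : InSkew μ λ′ (top , pred (M top))
    last∈ = ℕ.≤-reflexive suc-pred , ℕ.≤⇒≯ (ℕ.<⇒≤pred top-occupied)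

  head : pos M top ≡ beadTo i
  head = trans (pos≡diag+1 top suc-c) (cong (ℤ._+ 1ℤ) on-diagonal)

  unoccupied-above : ∀ r → r < top → ¬ Occupied r
  unoccupied-above r r<top occ = ℕ.<⇒≱ r<top (proj₁ (topmost (r , L r) (first-box occ)))

  above : ∀ r → r < top → M r ≡ L r
  above r r<top = ℕ.≤-antisym (ℕ.≮⇒≥ (unoccupied-above r r<top)) (λ⊆μ r)

  overhang-≤ : ∀ r → M (suc r) ≤ suc (L r)
  overhang-≤ r = ℕ.≮⇒≥ λ 1+L<M′ → no-2x2 (r , L r ,
    (ℕ.<-≤-trans (ℕ.<-trans (ℕ.n<1+n (L r)) 1+L<M′) (decM r) , ℕ.<-irrefl refl) ,
    (ℕ.<-trans (ℕ.n<1+n _) 1+L<M′ , ℕ.≤⇒≯ (decL r)) ,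
    (ℕ.<-≤-trans 1+L<M′ (decM r) , ℕ.≤⇒≯ (ℕ.n≤1+n (L r))) ,
    (1+L<M′ , ℕ.≤⇒≯ (ℕ.m≤n⇒m≤1+n (decL r))))
    where
    decM = row-decreasing μ
    decL = row-decreasing λ′

  last-search : Least (λ k → ¬ Occupied (suc (k + top)))
  last-search = least (λ k → ¬? (L (suc (k + top)) ℕ.<? M (suc (k + top)))) {ℓ μ}
    (λ occ → ℕ.n≮0 (subst (L (suc (ℓ μ + top)) <_) (row-beyond μ (ℕ.m≤n⇒m≤1+n (ℕ.m≤m+n (ℓ μ) top))) occ))

  open Least last-search using () renaming (value to s′; holds to next-unoccupied)

  rows-occupied : ∀ k → k ≤ s′ → Occupied (k + top)
  rows-occupied zero    _    = top-occupied
  rows-occupied (suc k) k<s′ = decidable-stable (_ ℕ.<? _) (Least.minimal last-search k k<s′)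

  unoccupied-below : ∀ r → suc (s′ + top) ≤ r → ¬ Occupied r
  unoccupied-below r span≤r occ with crossing top-occupied occ (s′ + top) (ℕ.m≤n+m top s′) span≤r
  ... | _ , _ , next∈ = next-unoccupied (box⇒occupied next∈)

  below : ∀ r → suc (s′ + top) ≤ r → M r ≡ L r
  below r span≤r = ℕ.≤-antisym (ℕ.≮⇒≥ (unoccupied-below r span≤r)) (λ⊆μ r)

  overhang : ∀ k → k < s′ → M (suc (k + top)) ≡ suc (L (k + top))
  overhang k k<s′ with crossing top-occupied (rows-occupied (suc k) k<s′) (k + top) (ℕ.m≤n+m top k) ℕ.≤-refl
  ... | _ , k∈ , 1+k∈ = ℕ.≤-antisym (overhang-≤ (k + top)) (ℕ.≤-<-trans (ℕ.≮⇒≥ (proj₂ k∈)) (proj₁ 1+k∈))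

  last-row<ℓ : suc (s′ + top) ≤ ℓ μ
  last-row<ℓ = row-positive⇒<ℓ μ (ℕ.≤-<-trans z≤n (rows-occupied s′ ℕ.≤-refl))

  s′≡s : s′ ≡ s
  s′≡s = ℕ.suc-injective (trans (sym count) (trans (sym (rowsOf≡sumBelow μ λ′)) rows≡))
    where
    count : sumBelow (ℓ μ) (occupied M L) ≡ suc s′
    count = sumBelow-block top (suc s′) (ℓ μ) last-row<ℓ
      (λ r r<top → occupied-0 M L (unoccupied-above r r<top))
      (λ k k≤s′ → occupied-1 M L (rows-occupied k (ℕ.≤-pred k≤s′)))
      (λ r span≤r → occupied-0 M L (unoccupied-below r span≤r))

  ribbonRows : RibbonRows M L (beadFrom i n) (beadTo i) s
  ribbonRows = subst (RibbonRows M L (beadFrom i n) (beadTo i)) s′≡s record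
    { top      = top
    ; above    = above
    ; overhang = overhang
    ; below    = below
    ; head     = head
    ; tail     = size⇒tail size≡
    }
    where open RibbonSize μ λ′ top s′ last-row<ℓ (⊆⇒ℓ≤ {λ′} {μ} λ⊆μ) above overhang below {i} head n

ribbon⇒rows : ∀ n μ λ′ i {s} →
  Ribbon n μ λ′ i s → RibbonRows (row μ) (row λ′) (beadFrom i n) (beadTo i) s
ribbon⇒rows n μ λ′ i (λ⊆μ , size≡ , conn , no-2x2 , ((top , c) , head∈ , on-diagonal , topmost) , rows≡) =
  Ribbon⇒RibbonRows.ribbonRows λ⊆μ size≡ conn no-2x2 top c head∈ on-diagonal topmost rows≡

rows⇒ribbon : ∀ n μ λ′ i {s} → 1 ≤ n →
  RibbonRows (row μ) (row λ′) (beadFrom i n) (beadTo i) s → Ribbon n μ λ′ i s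
rows⇒ribbon n μ λ′ i 1≤n rr = RibbonRows⇒Ribbon.ribbon 1≤n rr

-- Commutation of u_i and d_j

between-exchange< : ∀ {p q p′ q′} n → q ≡ p ℤ.+ + n → q′ ≡ p′ ℤ.+ + n → p ℤ.< p′ →
  between p q p′ + between p′ q′ p ≡ between p q q′ + between p′ q′ q
between-exchange< {p} {q} {p′} {q′} n refl refl p<p′ = by-cases (p′ ℤ.<? q)
  where
  q<q′ : q ℤ.< q′
  q<q′ = ℤ.+-monoˡ-< (+ n) p<p′
  by-cases : Dec (p′ ℤ.< q) → between p q p′ + between p′ q′ p ≡ between p q q′ + between p′ q′ q
  by-cases (yes p′<q) = begin
    between p q p′ + between p′ q′ p
      ≡⟨ cong₂ _+_ (between-inside p<p′ p′<q) (between-≤ (ℤ.<⇒≤ p<p′)) ⟩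
    1 + 0
      ≡⟨ cong₂ _+_ (sym (between-≥ (ℤ.<⇒≤ q<q′))) (sym (between-inside p′<q q<q′)) ⟩
    between p q q′ + between p′ q′ q ∎
  by-cases (no p′≮q) = begin
    between p q p′ + between p′ q′ p
      ≡⟨ cong₂ _+_ (between-≥ (ℤ.≮⇒≥ p′≮q)) (between-≤ (ℤ.<⇒≤ p<p′)) ⟩
    0 + 0
      ≡⟨ cong₂ _+_ (sym (between-≥ (ℤ.<⇒≤ q<q′))) (sym (between-≤ (ℤ.≮⇒≥ p′≮q))) ⟩
    between p q q′ + between p′ q′ q ∎

between-exchange : ∀ {p q p′ q′} n → q ≡ p ℤ.+ + n → q′ ≡ p′ ℤ.+ + n → p ≢ p′ →
  between p q p′ + between p′ q′ p ≡ between p q q′ + between p′ q′ q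
between-exchange {p} {q} {p′} {q′} n q≡ q′≡ p≢p′ with ℤ.<-cmp p p′
... | tri< p<p′ _ _ = between-exchange< n q≡ q′≡ p<p′
... | tri≈ _ p≡p′ _ = contradiction p≡p′ p≢p′
... | tri> _ _ p>p′ = begin
  between p q p′ + between p′ q′ p    ≡⟨ ℕ.+-comm (between p q p′) _ ⟩
  between p′ q′ p + between p q p′    ≡⟨ between-exchange< n q′≡ q≡ p>p′ ⟩
  between p′ q′ q + between p q q′    ≡⟨ ℕ.+-comm (between p′ q′ q) _ ⟩
  between p q q′ + between p′ q′ q    ∎

module Commutation (n : ℕ) (1≤n : 1 ≤ n) (i j : ℤ) (i≢j : i ≢ j) where

  private
    P Q : ℤ → ℤ
    P k = beadFrom k n
    Q k = beadTo k

    P<Q : ∀ k → P k ℤ.< Q k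
    P<Q k = beadFrom<beadTo k 1≤n

    Q≡P+n : ∀ k → Q k ≡ P k ℤ.+ + n
    Q≡P+n k = sym ([i-j]+j≡i (+ n) (Q k))

    Qi≢Qj : Q i ≢ Q j
    Qi≢Qj Qi≡Qj = i≢j (+-cancelʳ-≡ℤ 1ℤ i j Qi≡Qj)

    Pi≢Pj : P i ≢ P j
    Pi≢Pj Pi≡Pj = Qi≢Qj (trans (Q≡P+n i) (trans (cong (ℤ._+ + n) Pi≡Pj) (sym (Q≡P+n j))))

  RibbonRowsᵢ RibbonRowsⱼ : Partition → Partition → ℕ → Set
  RibbonRowsᵢ μ λ′ s = RibbonRows (row μ) (row λ′) (P i) (Q i) s
  RibbonRowsⱼ μ λ′ s = RibbonRows (row μ) (row λ′) (P j) (Q j) s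

  -- Each spin counts the beads of the smaller partition inside the interval of its move; the two
  -- i-spins (resp. j-spins) are counted in partitions that differ by the j-move (resp. i-move).
  square-spins : ∀ ν λ′ μ ρ {s₁ t₁ t₂ s₂} →
    RibbonRowsⱼ λ′ ν s₁ → RibbonRowsᵢ μ ν t₁ → RibbonRowsᵢ ρ λ′ t₂ → RibbonRowsⱼ ρ μ s₂ →
    t₂ + s₂ ≡ t₁ + s₁
  square-spins ν λ′ μ ρ {s₁} {t₁} {t₂} {s₂} λ/ν μ/ν ρ/λ ρ/μ =
    ℕ.+-cancelʳ-≡ (Iᵢ (P j) + Iⱼ (P i)) (t₂ + s₂) (t₁ + s₁) (begin
      t₂ + s₂ + (Iᵢ (P j) + Iⱼ (P i))   ≡⟨ +-interchange t₂ s₂ (Iᵢ (P j)) (Iⱼ (P i)) ⟩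
      (t₂ + Iᵢ (P j)) + (s₂ + Iⱼ (P i)) ≡⟨ cong₂ _+_ i-count j-count ⟩
      (t₁ + Iᵢ (Q j)) + (s₁ + Iⱼ (Q i)) ≡⟨ +-interchange t₁ (Iᵢ (Q j)) s₁ (Iⱼ (Q i)) ⟩
      t₁ + s₁ + (Iᵢ (Q j) + Iⱼ (Q i))   ≡⟨ cong (_+_ (t₁ + s₁)) (sym exchange) ⟩
      t₁ + s₁ + (Iᵢ (P j) + Iⱼ (P i))   ∎)
    where
    module λ/ν = PartitionRibbon λ′ ν λ/ν (P<Q j)
    module μ/ν = PartitionRibbon μ ν μ/ν (P<Q i)
    module ρ/λ = PartitionRibbon ρ λ′ ρ/λ (P<Q i)
    module ρ/μ = PartitionRibbon ρ μ ρ/μ (P<Q j)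
    Iᵢ Iⱼ : ℤ → ℕ
    Iᵢ = between (P i) (Q i)
    Iⱼ = between (P j) (Q j)
    N : ℕ
    N = ℓ ρ
    i-count : t₂ + Iᵢ (P j) ≡ t₁ + Iᵢ (Q j)
    i-count = subst₂ (λ x y → x + Iᵢ (P j) ≡ y + Iᵢ (Q j))
      (ρ/λ.spin≡beadsBetween N ρ/λ.span≤ℓ)
      (μ/ν.spin≡beadsBetween N (ℕ.≤-trans μ/ν.span≤ℓ ρ/μ.ℓ≤ℓ))
      (λ/ν.sum-exchange Iᵢ N (ℕ.≤-trans λ/ν.span≤ℓ ρ/λ.ℓ≤ℓ))
    j-count : s₂ + Iⱼ (P i) ≡ s₁ + Iⱼ (Q i)
    j-count = subst₂ (λ x y → x + Iⱼ (P i) ≡ y + Iⱼ (Q i))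
      (ρ/μ.spin≡beadsBetween N ρ/μ.span≤ℓ)
      (λ/ν.spin≡beadsBetween N (ℕ.≤-trans λ/ν.span≤ℓ ρ/λ.ℓ≤ℓ))
      (μ/ν.sum-exchange Iⱼ N (ℕ.≤-trans μ/ν.span≤ℓ ρ/μ.ℓ≤ℓ))
    exchange : Iᵢ (P j) + Iⱼ (P i) ≡ Iᵢ (Q j) + Iⱼ (Q i)
    exchange = between-exchange n (Q≡P+n i) (Q≡P+n j) Pi≢Pj

  complete-up : ∀ ν λ′ μ {s₁ t₁} → RibbonRowsⱼ λ′ ν s₁ → RibbonRowsᵢ μ ν t₁ →
    Σ Partition λ ρ → Σ ℕ λ t₂ → Σ ℕ λ s₂ → RibbonRowsᵢ ρ λ′ t₂ × RibbonRowsⱼ ρ μ s₂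
  complete-up ν λ′ μ λ/ν μ/ν =
    join (addRibbon λ′ (P<Q i) (proj₁ λ-beads) (proj₂ λ-beads))
         (addRibbon μ (P<Q j) (proj₁ μ-beads) (proj₂ μ-beads))
    where
    module λ/ν = PartitionRibbon λ′ ν λ/ν (P<Q j)
    module μ/ν = PartitionRibbon μ ν μ/ν (P<Q i)
    λ-beads : Bead (row λ′) (P i) × ¬ Bead (row λ′) (Q i)
    λ-beads = Move-independent λ/ν.move μ/ν.move (≢-sym Pi≢Pj) (≢-sym Qi≢Qj)
    μ-beads : Bead (row μ) (P j) × ¬ Bead (row μ) (Q j)
    μ-beads = Move-independent μ/ν.move λ/ν.move Pi≢Pj Qi≢Qj
    join : (Σ Partition λ ρ → Σ ℕ λ t₂ → RibbonRowsᵢ ρ λ′ t₂) →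
           (Σ Partition λ ρ′ → Σ ℕ λ s₂ → RibbonRowsⱼ ρ′ μ s₂) →
           Σ Partition λ ρ → Σ ℕ λ t₂ → Σ ℕ λ s₂ → RibbonRowsᵢ ρ λ′ t₂ × RibbonRowsⱼ ρ μ s₂
    join (ρ , t₂ , ρ/λ) (ρ′ , s₂ , ρ′/μ) = ρ , t₂ , s₂ , ρ/λ , RibbonRows-congˡ ρ′≗ρ ρ′/μ
      where
      module ρ/λ = PartitionRibbon ρ λ′ ρ/λ (P<Q i)
      module ρ′/μ = PartitionRibbon ρ′ μ ρ′/μ (P<Q j)
      ρ′≗ρ : ∀ r → row ρ′ r ≡ row ρ r
      ρ′≗ρ = same-beads⇒same-rows ρ′ ρ
        (Move-commute μ/ν.move ρ′/μ.move λ/ν.move ρ/λ.move)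
        (Move-commute λ/ν.move ρ/λ.move μ/ν.move ρ′/μ.move)

  complete-down : ∀ ρ λ′ μ {t₂ s₂} → RibbonRowsᵢ ρ λ′ t₂ → RibbonRowsⱼ ρ μ s₂ →
    Σ Partition λ ν → Σ ℕ λ s₁ → Σ ℕ λ t₁ → RibbonRowsⱼ λ′ ν s₁ × RibbonRowsᵢ μ ν t₁
  complete-down ρ λ′ μ ρ/λ ρ/μ =
    join (removeRibbon λ′ (P<Q j) (proj₁ λ-beads) (proj₂ λ-beads))
         (removeRibbon μ (P<Q i) (proj₁ μ-beads) (proj₂ μ-beads))
    where
    ρ→λ : Move (Bead (row ρ)) (Bead (row λ′)) (Q i) (P i)
    ρ→λ = Move-reverse (PartitionRibbon.move ρ λ′ ρ/λ (P<Q i))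
    ρ→μ : Move (Bead (row ρ)) (Bead (row μ)) (Q j) (P j)
    ρ→μ = Move-reverse (PartitionRibbon.move ρ μ ρ/μ (P<Q j))
    λ-beads : Bead (row λ′) (Q j) × ¬ Bead (row λ′) (P j)
    λ-beads = Move-independent ρ→λ ρ→μ Qi≢Qj Pi≢Pj
    μ-beads : Bead (row μ) (Q i) × ¬ Bead (row μ) (P i)
    μ-beads = Move-independent ρ→μ ρ→λ (≢-sym Qi≢Qj) (≢-sym Pi≢Pj)
    join : (Σ Partition λ ν → Σ ℕ λ s₁ → RibbonRowsⱼ λ′ ν s₁) →
           (Σ Partition λ ν′ → Σ ℕ λ t₁ → RibbonRowsᵢ μ ν′ t₁) →
           Σ Partition λ ν → Σ ℕ λ s₁ → Σ ℕ λ t₁ → RibbonRowsⱼ λ′ ν s₁ × RibbonRowsᵢ μ ν t₁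
    join (ν , s₁ , λ/ν) (ν′ , t₁ , μ/ν′) = ν , s₁ , t₁ , λ/ν , RibbonRows-congʳ ν′≗ν μ/ν′
      where
      λ→ν : Move (Bead (row λ′)) (Bead (row ν)) (Q j) (P j)
      λ→ν = Move-reverse (PartitionRibbon.move λ′ ν λ/ν (P<Q j))
      μ→ν′ : Move (Bead (row μ)) (Bead (row ν′)) (Q i) (P i)
      μ→ν′ = Move-reverse (PartitionRibbon.move μ ν′ μ/ν′ (P<Q i))
      ν′≗ν : ∀ r → row ν′ r ≡ row ν r
      ν′≗ν = same-beads⇒same-rows ν′ ν
        (Move-commute ρ→μ μ→ν′ ρ→λ λ→ν) (Move-commute ρ→λ λ→ν ρ→μ μ→ν′)

lemma5p1 : (n : ℕ) → 1 ≤ n → (i j : ℤ) → ¬ (i ≡ j) →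
    (λ' μ : Partition) (a : ℕ) → UD n i j λ' a μ ⇔ DU n i j λ' a μ
lemma5p1 n 1≤n i j i≢j λ′ μ a = mk⇔ ud⇒du du⇒ud
  where
  open Commutation n 1≤n i j i≢j

  ud⇒du : UD n i j λ′ a μ → DU n i j λ′ a μ
  ud⇒du (ν , s , t , λ/ν , μ/ν , s+t≡a) =
    let λ/ν′ = ribbon⇒rows n λ′ ν j λ/ν
        μ/ν′ = ribbon⇒rows n μ ν i μ/ν
        (ρ , t′ , s′ , ρ/λ , ρ/μ) = complete-up ν λ′ μ λ/ν′ μ/ν′
    in ρ , t′ , s′ , rows⇒ribbon n ρ λ′ i 1≤n ρ/λ , rows⇒ribbon n ρ μ j 1≤n ρ/μ ,
       trans (square-spins ν λ′ μ ρ λ/ν′ μ/ν′ ρ/λ ρ/μ) (trans (ℕ.+-comm t s) s+t≡a)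

  du⇒ud : DU n i j λ′ a μ → UD n i j λ′ a μ
  du⇒ud (ρ , s , t , ρ/λ , ρ/μ , s+t≡a) =
    let ρ/λ′ = ribbon⇒rows n ρ λ′ i ρ/λ
        ρ/μ′ = ribbon⇒rows n ρ μ j ρ/μ
        (ν , s′ , t′ , λ/ν , μ/ν) = complete-down ρ λ′ μ ρ/λ′ ρ/μ′
    in ν , s′ , t′ , rows⇒ribbon n λ′ ν j 1≤n λ/ν , rows⇒ribbon n μ ν i 1≤n μ/ν ,
       trans (ℕ.+-comm s′ t′) (trans (sym (square-spins ν λ′ μ ρ λ/ν μ/ν ρ/λ′ ρ/μ′)) s+t≡a)
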